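{- Let $G$ be a finite multigraph (loops allowed) with vertex set $V(G)$ and edge set $E(G)$. Sums below run over all spanning subgraphs $H$ of $G$, i.e. $V(H)=V(G)$ and $E(H)$ ranges over all subsets of $E(G)$. Then, as identities of rational functions in $q$, $$F_G(q)\,(\zeta_q(-1))^{|E(G)|}=\sum_{H\subseteq G}(-1)^{|E(G)|-|E(H)|}\frac{P_H(q)}{q^{|V(H)|}}(\zeta_q(1))^{|E(H)|},$$ $$\frac{P_G(q)}{q^{|V(G)|}}(\zeta_q(1))^{|E(G)|}=\sum_{H\subseteq G}(\zeta_q(-1))^{|E(H)|}F_H(q),$$ $$F_G(q)\,q^{|V(G)|}=\sum_{H\subseteq G}(-1)^{|E(G)|-|E(H)|}(q-1)^{|E(H)|}P_{G/H}(q).$$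
   Context: $P_H(q)$ is the chromatic polynomial of $H$ (number of proper vertex colourings with $q$ colours; it is $0$ if $H$ has a loop). $F_H(q)$ is the flow polynomial of $H$ (for an abelian group of order $q$, the number of nowhere-zero flows on an arbitrary orientation of $H$ with values in that group; equivalently the characteristic polynomial of the dual of the cycle matroid of $H$). $G/H$ is the multigraph obtained from $G$ by contracting all edges of $H$. $\zeta_q(z)=\frac{1}{1-q^{ -z}}$, so $\zeta_q(1)=\frac{1}{1-q^{ -1}}$ and $\zeta_q(-1)=\frac{1}{1-q}$. -}

module Defs where

open import Data.Nat as ℕ using (ℕ; zero; suc; _∸_; _≡ᵇ_; _%_)
open import Data.Bool using (Bool; true; false; not; _∧_; if_then_else_)
open import Data.Fin using (Fin; toℕ; punchOut; _≟_)
open import Data.List as List using (List; []; _∷_; map; concatMap; allFin; zip; length; filter)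
open import Data.Vec as Vec using (Vec; []; _∷_; lookup)
open import Data.Product using (_×_; _,_; proj₁; proj₂)
open import Data.Integer using (ℤ; +_)
open import Data.Rational as ℚ using (ℚ; 0ℚ; 1ℚ; _+_; _*_; _/_; -_)
open import Relation.Nullary using (yes; no)
open import Relation.Binary.PropositionalEquality using (_≡_; _≢_; sym)
open import Function using (_∘_)

-- Vertex set Fin n; edges form a list, each edge (u , v) carrying the
-- (arbitrary, fixed) orientation u → v.

record Multigraph : Set where
  constructor mkG
  field
    n     : ℕ
    edges : List (Fin n × Fin n)

open Multigraph public

|V| : Multigraph → ℕ
|V| G = n G

|E| : Multigraph → ℕ
|E| G = length (edges G)

-- Spanning subgraphs: a spanning subgraph H ⊆ G is a choice, for every
-- edge of G, of whether it belongs to E(H).  We encode it as a marking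
-- of the edge list of G (true = edge is in H).

markings : {A : Set} → List A → List (List (Bool × A))
markings []       = [] ∷ []
markings (e ∷ es) = concatMap (λ ms → ((true , e) ∷ ms) ∷ ((false , e) ∷ ms) ∷ []) (markings es)

Spanning : (G : Multigraph) → List (List (Bool × (Fin (n G) × Fin (n G))))
Spanning G = markings (edges G)

subgraph : (G : Multigraph) → List (Bool × (Fin (n G) × Fin (n G))) → Multigraph
subgraph G ms = mkG (n G) (map proj₂ (filter (λ p → Data.Bool._≟_ (proj₁ p) true) ms))
  where import Data.Bool

-- Contracting a loop deletes it; contracting a non-loop edge u v
-- identifies v with u (vertex v is removed, the rest renumbered by
-- punchOut).

merge : ∀ {m} (u v : Fin (suc m)) → v ≢ u → Fin (suc m) → Fin m
merge u v v≢u w with w ≟ v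
... | yes _   = punchOut v≢u
... | no w≢v  = punchOut {i = v} {j = w} (w≢v ∘ sym)

mapEdge : ∀ {a b} → (Fin a → Fin b) → Fin a × Fin a → Fin b × Fin b
mapEdge φ (x , y) = (φ x , φ y)

contractAux : (k m : ℕ) → List (Fin m × Fin m) → Vec (Bool × (Fin m × Fin m)) k → Multigraph
contractEdge : (k m : ℕ) → (u v : Fin m) → v ≢ u → List (Fin m × Fin m) →
               Vec (Bool × (Fin m × Fin m)) k → Multigraph

contractAux zero    m done []                        = mkG m done
contractAux (suc k) m done ((false , e) ∷ rest)      = contractAux k m (e ∷ done) rest
contractAux (suc k) m done ((true , (u , v)) ∷ rest) with v ≟ u
... | yes _   = contractAux k m done rest
... | no v≢u  = contractEdge k m u v v≢u done rest

contractEdge k (suc m) u v v≢u done rest =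
  contractAux k m (map (mapEdge φ) done) (Vec.map (λ p → (proj₁ p , mapEdge φ (proj₂ p))) rest)
  where φ = merge u v v≢u

contract : (G : Multigraph) → List (Bool × (Fin (n G) × Fin (n G))) → Multigraph
contract G ms = contractAux (length ms) (n G) [] (Vec.fromList ms)

allB : {A : Set} → (A → Bool) → List A → Bool
allB p []       = true
allB p (x ∷ xs) = p x ∧ allB p xs

countB : {A : Set} → (A → Bool) → List A → ℕ
countB p []       = 0
countB p (x ∷ xs) = if p x then suc (countB p xs) else countB p xs

allVec : (n q : ℕ) → List (Vec (Fin q) n)
allVec zero    q = [] ∷ []
allVec (suc n) q = concatMap (λ c → map (c ∷_) (allVec n q)) (allFin q)

-- Chromatic polynomial evaluated at q: number of proper colourings of
-- the vertices with q colours (a loop makes this 0).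

proper : (G : Multigraph) {q : ℕ} → Vec (Fin q) (n G) → Bool
proper G c = allB (λ e → not (toℕ (lookup c (proj₁ e)) ≡ᵇ toℕ (lookup c (proj₂ e)))) (edges G)

P : Multigraph → ℕ → ℕ
P G q = countB (proper G) (allVec (n G) q)

-- Flow polynomial evaluated at q: number of nowhere-zero flows with
-- values in the abelian group ℤ/qℤ (represented by Fin q with addition
-- mod q) on the fixed orientation of G.

sumℕ : List ℕ → ℕ
sumℕ = List.foldr ℕ._+_ 0

module _ (G : Multigraph) {q : ℕ} where
  private
    fl : Vec (Fin q) (|E| G) → List (Fin q × (Fin (n G) × Fin (n G)))
    fl f = zip (Vec.toList f) (edges G)

  inflow outflow : Vec (Fin q) (|E| G) → Fin (n G) → ℕ
  inflow  f v = sumℕ (map (λ p → if toℕ (proj₂ (proj₂ p)) ≡ᵇ toℕ v then toℕ (proj₁ p) else 0) (fl f))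
  outflow f v = sumℕ (map (λ p → if toℕ (proj₁ (proj₂ p)) ≡ᵇ toℕ v then toℕ (proj₁ p) else 0) (fl f))

  nowhereZero : Vec (Fin q) (|E| G) → Bool
  nowhereZero f = allB (λ x → not (toℕ x ≡ᵇ 0)) (Vec.toList f)

  conserving : .{{_ : ℕ.NonZero q}} → Vec (Fin q) (|E| G) → Bool
  conserving f = allB (λ v → (inflow f v % q) ≡ᵇ (outflow f v % q)) (allFin (n G))

  isNZFlow : .{{_ : ℕ.NonZero q}} → Vec (Fin q) (|E| G) → Bool
  isNZFlow f = nowhereZero f ∧ conserving f

F : Multigraph → (q : ℕ) → .{{_ : ℕ.NonZero q}} → ℕ
F G q = countB (isNZFlow G) (allVec (|E| G) q)

_^_ : ℚ → ℕ → ℚ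
x ^ zero  = 1ℚ
x ^ suc k = x * (x ^ k)

ℕ→ℚ : ℕ → ℚ
ℕ→ℚ k = + k / 1

Σℚ : {A : Set} → List A → (A → ℚ) → ℚ
Σℚ xs f = List.foldr _+_ 0ℚ (map f xs)

-- ζ_q(z) = 1 / (1 - q^(-z)) at z = 1 and z = -1, for q = k + 2
-- (closed forms: ζ_q(1) = q/(q-1), ζ_q(-1) = 1/(1-q) = -1/(q-1)).

ζ₁ : ℕ → ℚ
ζ₁ k = + suc (suc k) / suc k

ζ₋₁ : ℕ → ℚ
ζ₋₁ k = - (+ 1 / suc k)

-- 1/q for q = k + 2
inv : ℕ → ℚ
inv k = + 1 / suc (suc k)

|E|of : {A : Set} → List (Bool × A) → ℕ
|E|of ms = countB proj₁ ms

-- Every quantity is a sum over the q^|V| colourings c of G of a product over the edges.  P_G(q)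
-- counts the colourings with no monochromatic edge, and P_{G/H}(q) those in which the edges of H
-- are monochromatic and all other edges bichromatic.  Deletion–contraction applied to both sides
-- gives q^|V| F_G(q) = Σ_c Π_e w_c(e), where w_c(e) is q - 1 on monochromatic and -1 on
-- bichromatic edges: a loop may carry any of the q - 1 nonzero values, and for a non-loop edge e,
-- once the values on the other edges are fixed, exactly one value on e makes the flow conserving
-- if the induced flow on G/e is conserving and none otherwise, while the value 0 gives the flows
-- on G∖e; hence F_G = F_{G/e} - F_{G∖e}.
-- A sum over spanning subgraphs H of a product with one factor a_e for each edge in H and one
-- factor b_e for each edge outside H equals Π_e (a_e + b_e).  So each identity reduces to an
-- identity for a single edge in ζ_q(1) = 1 + 1/(q-1) and ζ_q(-1) = -1/(q-1), checked separately
-- for monochromatic and bichromatic edges.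

module Submission where

open import Defs
open import Level using (0ℓ)
open import Function using (id; _∘_; const)
open import Function.Bundles using (Equivalence)
open import Data.Empty using (⊥-elim)
open import Data.Unit using (tt)
open import Data.Bool using (Bool; true; false; T; if_then_else_; not; _∧_)
import Data.Bool.Properties as BoolP
open import Data.Product using (_×_; _,_; proj₁; proj₂)
open import Data.Nat as ℕ using (ℕ; zero; suc; _∸_; _≡ᵇ_)
import Data.Nat.Properties as ℕP
open import Data.Nat.DivMod
  using (_%_; %-distribˡ-+; m%n%n≡m%n; m%n<n; m<n⇒m%n≡m; [m+kn]%n≡m%n; m≡m%n+[m/n]*n; n%n≡0)
import Data.Integer as ℤ
open import Data.Integer.Tactic.RingSolver using (solve-∀)
open import Data.Rational using (ℚ; 0ℚ; 1ℚ; _+_; _*_; -_; _/_; toℚᵘ)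
import Data.Rational.Properties as ℚP
open import Data.Rational.Solver using (module +-*-Solver)
open import Data.Rational.Unnormalised as ℚᵘ using (mkℚᵘ; _≃_; *≡*)
import Data.Rational.Unnormalised.Properties as ℚᵘP
open import Data.Fin as Fin using (Fin; zero; suc; toℕ; punchIn; punchOut)
import Data.Fin.Properties as FinP
open import Data.List as List using (List; []; _∷_; map; concatMap; allFin; length; _++_)
import Data.List.Properties as ListP
open import Data.List.Relation.Unary.All as All using (All; []; _∷_)
import Data.List.Relation.Unary.All.Properties as AllP
open import Data.Vec as Vec using (Vec; []; _∷_; lookup; tabulate; insertAt)
import Data.Vec.Properties as VecP
open import Relation.Nullary using (Dec; yes; no)
open import Relation.Nullary.Decidable using (dec-true; dec-false)
open import Relation.Binary using (Setoid)
import Relation.Binary.Reasoning.Setoid as SetoidReasoning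
open import Relation.Binary.PropositionalEquality
import Algebra.Properties.CommutativeSemigroup as CommSemigroupProperties

open +-*-Solver

toℚᵘ-/ : (i : ℤ.ℤ) (d : ℕ) → toℚᵘ (i / suc d) ≃ mkℚᵘ i d
toℚᵘ-/ i d = ℚP.toℚᵘ-fromℚᵘ (mkℚᵘ i d)

ℕ→ℚ-suc : (n : ℕ) → ℕ→ℚ (suc n) ≡ 1ℚ + ℕ→ℚ n
ℕ→ℚ-suc n = ℚP.toℚᵘ-injective (begin
  toℚᵘ (ℕ→ℚ (suc n))                  ≈⟨ toℚᵘ-/ (ℤ.+ suc n) 0 ⟩
  mkℚᵘ (ℤ.+ suc n) 0                  ≈⟨ *≡* (ring (ℤ.+ n)) ⟩
  mkℚᵘ (ℤ.+ 1) 0 ℚᵘ.+ mkℚᵘ (ℤ.+ n) 0  ≈⟨ ℚᵘP.+-congʳ (mkℚᵘ (ℤ.+ 1) 0) (toℚᵘ-/ (ℤ.+ n) 0) ⟨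
  toℚᵘ 1ℚ ℚᵘ.+ toℚᵘ (ℕ→ℚ n)           ≈⟨ ℚP.toℚᵘ-homo-+ 1ℚ (ℕ→ℚ n) ⟨
  toℚᵘ (1ℚ + ℕ→ℚ n)                   ∎)
  where
  open ℚᵘP.≃-Reasoning
  ring : ∀ x → (ℤ.+ 1 ℤ.+ x) ℤ.* ℤ.+ 1 ≡ (ℤ.+ 1 ℤ.* ℤ.+ 1 ℤ.+ x ℤ.* ℤ.+ 1) ℤ.* ℤ.+ 1
  ring = solve-∀

ℕ→ℚ-*-recip : (d : ℕ) → ℕ→ℚ (suc d) * (ℤ.+ 1 / suc d) ≡ 1ℚ
ℕ→ℚ-*-recip d = ℚP.toℚᵘ-injective (begin
  toℚᵘ (ℕ→ℚ (suc d) * (ℤ.+ 1 / suc d))         ≈⟨ ℚP.toℚᵘ-homo-* (ℕ→ℚ (suc d)) (ℤ.+ 1 / suc d) ⟩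
  toℚᵘ (ℕ→ℚ (suc d)) ℚᵘ.* toℚᵘ (ℤ.+ 1 / suc d)  ≈⟨ ℚᵘP.*-cong (toℚᵘ-/ (ℤ.+ suc d) 0) (toℚᵘ-/ (ℤ.+ 1) d) ⟩
  mkℚᵘ (ℤ.+ suc d) 0 ℚᵘ.* mkℚᵘ (ℤ.+ 1) d        ≈⟨ *≡* (ring (ℤ.+ d)) ⟩
  toℚᵘ 1ℚ                                      ∎)
  where
  open ℚᵘP.≃-Reasoning
  ring : ∀ x → (ℤ.+ 1 ℤ.+ x) ℤ.* ℤ.+ 1 ℤ.* ℤ.+ 1 ≡ ℤ.+ 1 ℤ.* (ℤ.+ 1 ℤ.* (ℤ.+ 1 ℤ.+ x))
  ring = solve-∀

ζ₁≡1+recip : (k : ℕ) → ζ₁ k ≡ 1ℚ + ℤ.+ 1 / suc k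
ζ₁≡1+recip k = ℚP.toℚᵘ-injective (begin
  toℚᵘ (ζ₁ k)                         ≈⟨ toℚᵘ-/ (ℤ.+ suc (suc k)) k ⟩
  mkℚᵘ (ℤ.+ suc (suc k)) k            ≈⟨ *≡* (ring (ℤ.+ k)) ⟩
  mkℚᵘ (ℤ.+ 1) 0 ℚᵘ.+ mkℚᵘ (ℤ.+ 1) k  ≈⟨ ℚᵘP.+-congʳ (mkℚᵘ (ℤ.+ 1) 0) (toℚᵘ-/ (ℤ.+ 1) k) ⟨
  toℚᵘ 1ℚ ℚᵘ.+ toℚᵘ (ℤ.+ 1 / suc k)   ≈⟨ ℚP.toℚᵘ-homo-+ 1ℚ (ℤ.+ 1 / suc k) ⟨
  toℚᵘ (1ℚ + ℤ.+ 1 / suc k)           ∎)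
  where
  open ℚᵘP.≃-Reasoning
  ring : ∀ x → (ℤ.+ 2 ℤ.+ x) ℤ.* (ℤ.+ 1 ℤ.* (ℤ.+ 1 ℤ.+ x))
             ≡ (ℤ.+ 1 ℤ.* (ℤ.+ 1 ℤ.+ x) ℤ.+ ℤ.+ 1 ℤ.* ℤ.+ 1) ℤ.* (ℤ.+ 1 ℤ.+ x)
  ring = solve-∀

Πℚ : {A : Set} → List A → (A → ℚ) → ℚ
Πℚ xs f = List.foldr _*_ 1ℚ (map f xs)

module _ {A : Set} where

  Σℚ-cong : (xs : List A) {f g : A → ℚ} → (∀ x → f x ≡ g x) → Σℚ xs f ≡ Σℚ xs g
  Σℚ-cong []       f≗g = refl
  Σℚ-cong (x ∷ xs) f≗g = cong₂ _+_ (f≗g x) (Σℚ-cong xs f≗g)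

  Σℚ-congᴬ : (xs : List A) {f g : A → ℚ} → All (λ x → f x ≡ g x) xs → Σℚ xs f ≡ Σℚ xs g
  Σℚ-congᴬ []       []         = refl
  Σℚ-congᴬ (x ∷ xs) (fx≡gx ∷ p) = cong₂ _+_ fx≡gx (Σℚ-congᴬ xs p)

  Σℚ-++ : (xs ys : List A) (f : A → ℚ) → Σℚ (xs ++ ys) f ≡ Σℚ xs f + Σℚ ys f
  Σℚ-++ []       ys f = sym (ℚP.+-identityˡ _)
  Σℚ-++ (x ∷ xs) ys f = trans (cong (f x +_) (Σℚ-++ xs ys f)) (sym (ℚP.+-assoc (f x) _ _))

  Σℚ-zero : (xs : List A) → Σℚ xs (const 0ℚ) ≡ 0ℚ
  Σℚ-zero []       = refl
  Σℚ-zero (x ∷ xs) = trans (ℚP.+-identityˡ _) (Σℚ-zero xs)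

  Σℚ-+ : (xs : List A) (f g : A → ℚ) → Σℚ xs (λ x → f x + g x) ≡ Σℚ xs f + Σℚ xs g
  Σℚ-+ []       f g = refl
  Σℚ-+ (x ∷ xs) f g = trans (cong (f x + g x +_) (Σℚ-+ xs f g))
    (solve 4 (λ a b c d → (a :+ b) :+ (c :+ d) := (a :+ c) :+ (b :+ d)) refl (f x) (g x) (Σℚ xs f) (Σℚ xs g))

  Σℚ-neg : (xs : List A) (f : A → ℚ) → Σℚ xs (λ x → - f x) ≡ - Σℚ xs f
  Σℚ-neg []       f = refl
  Σℚ-neg (x ∷ xs) f = trans (cong (- f x +_) (Σℚ-neg xs f)) (sym (ℚP.neg-distrib-+ (f x) _))

  Σℚ-*ˡ : (xs : List A) (c : ℚ) (f : A → ℚ) → Σℚ xs (λ x → c * f x) ≡ c * Σℚ xs f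
  Σℚ-*ˡ []       c f = sym (ℚP.*-zeroʳ c)
  Σℚ-*ˡ (x ∷ xs) c f = trans (cong (c * f x +_) (Σℚ-*ˡ xs c f)) (sym (ℚP.*-distribˡ-+ c _ _))

  Σℚ-*ʳ : (xs : List A) (f : A → ℚ) (c : ℚ) → Σℚ xs (λ x → f x * c) ≡ Σℚ xs f * c
  Σℚ-*ʳ xs f c = trans (Σℚ-cong xs (λ x → ℚP.*-comm (f x) c))
                       (trans (Σℚ-*ˡ xs c f) (ℚP.*-comm c (Σℚ xs f)))

  Σℚ-sandwich : (xs : List A) (a b : ℚ) (f : A → ℚ) → a * Σℚ xs f * b ≡ Σℚ xs (λ x → a * f x * b)
  Σℚ-sandwich xs a b f = trans (cong (_* b) (sym (Σℚ-*ˡ xs a f))) (sym (Σℚ-*ʳ xs (λ x → a * f x) b))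

  Πℚ-cong : (xs : List A) {f g : A → ℚ} → (∀ x → f x ≡ g x) → Πℚ xs f ≡ Πℚ xs g
  Πℚ-cong []       f≗g = refl
  Πℚ-cong (x ∷ xs) f≗g = cong₂ _*_ (f≗g x) (Πℚ-cong xs f≗g)

  Πℚ-* : (xs : List A) (f g : A → ℚ) → Πℚ xs (λ x → f x * g x) ≡ Πℚ xs f * Πℚ xs g
  Πℚ-* []       f g = refl
  Πℚ-* (x ∷ xs) f g = trans (cong (f x * g x *_) (Πℚ-* xs f g))
    (solve 4 (λ a b c d → (a :* b) :* (c :* d) := (a :* c) :* (b :* d)) refl (f x) (g x) (Πℚ xs f) (Πℚ xs g))

  Πℚ-const : (xs : List A) (c : ℚ) → Πℚ xs (const c) ≡ c ^ length xs
  Πℚ-const []       c = refl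
  Πℚ-const (x ∷ xs) c = cong (c *_) (Πℚ-const xs c)

module _ {A B : Set} where

  Σℚ-map : (g : A → B) (xs : List A) (f : B → ℚ) → Σℚ (map g xs) f ≡ Σℚ xs (f ∘ g)
  Σℚ-map g []       f = refl
  Σℚ-map g (x ∷ xs) f = cong (f (g x) +_) (Σℚ-map g xs f)

  Πℚ-map : (g : A → B) (xs : List A) (f : B → ℚ) → Πℚ (map g xs) f ≡ Πℚ xs (f ∘ g)
  Πℚ-map g []       f = refl
  Πℚ-map g (x ∷ xs) f = cong (f (g x) *_) (Πℚ-map g xs f)

  Σℚ-concatMap : (g : A → List B) (xs : List A) (f : B → ℚ) →
                 Σℚ (concatMap g xs) f ≡ Σℚ xs (λ x → Σℚ (g x) f)
  Σℚ-concatMap g []       f = refl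
  Σℚ-concatMap g (x ∷ xs) f =
    trans (Σℚ-++ (g x) (concatMap g xs) f) (cong (Σℚ (g x) f +_) (Σℚ-concatMap g xs f))

  Σℚ-swap : (xs : List A) (ys : List B) (f : A → B → ℚ) →
            Σℚ xs (λ x → Σℚ ys (f x)) ≡ Σℚ ys (λ y → Σℚ xs (λ x → f x y))
  Σℚ-swap []       ys f = sym (Σℚ-zero ys)
  Σℚ-swap (x ∷ xs) ys f = trans (cong (Σℚ ys (f x) +_) (Σℚ-swap xs ys f))
                                (sym (Σℚ-+ ys (f x) (λ y → Σℚ xs (λ x → f x y))))

Σℚ-const : {A : Set} (xs : List A) (c : ℚ) → Σℚ xs (const c) ≡ ℕ→ℚ (length xs) * c
Σℚ-const []       c = sym (ℚP.*-zeroˡ c)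
Σℚ-const (x ∷ xs) c = begin
  c + Σℚ xs (const c)
    ≡⟨ cong (c +_) (Σℚ-const xs c) ⟩
  c + ℕ→ℚ (length xs) * c
    ≡⟨ solve 2 (λ c l → c :+ l :* c := (con 1ℚ :+ l) :* c) refl c (ℕ→ℚ (length xs)) ⟩
  (1ℚ + ℕ→ℚ (length xs)) * c
    ≡⟨ cong (_* c) (ℕ→ℚ-suc (length xs)) ⟨
  ℕ→ℚ (suc (length xs)) * c ∎
  where open ≡-Reasoning

ind : Bool → ℚ
ind b = if b then 1ℚ else 0ℚ

ind-∧ : (a b : Bool) → ind (a ∧ b) ≡ ind a * ind b
ind-∧ true  b = sym (ℚP.*-identityˡ (ind b))
ind-∧ false b = sym (ℚP.*-zeroˡ (ind b))

count-Σℚ : {A : Set} (p : A → Bool) (xs : List A) → ℕ→ℚ (countB p xs) ≡ Σℚ xs (ind ∘ p)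
count-Σℚ p []       = refl
count-Σℚ p (x ∷ xs) with p x
... | true  = trans (ℕ→ℚ-suc (countB p xs)) (cong (1ℚ +_) (count-Σℚ p xs))
... | false = trans (count-Σℚ p xs) (sym (ℚP.+-identityˡ _))

allB-Πℚ : {A : Set} (p : A → Bool) (xs : List A) → ind (allB p xs) ≡ Πℚ xs (ind ∘ p)
allB-Πℚ p []       = refl
allB-Πℚ p (x ∷ xs) = trans (ind-∧ (p x) (allB p xs)) (cong (ind (p x) *_) (allB-Πℚ p xs))

allB-cong : {A : Set} (xs : List A) {p r : A → Bool} → (∀ x → p x ≡ r x) → allB p xs ≡ allB r xs
allB-cong []       p≗r = refl
allB-cong (x ∷ xs) p≗r = cong₂ _∧_ (p≗r x) (allB-cong xs p≗r)

T-injective : {a b : Bool} → (T a → T b) → (T b → T a) → a ≡ b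
T-injective {true}  {true}  _ _ = refl
T-injective {true}  {false} f _ = ⊥-elim (f tt)
T-injective {false} {true}  _ g = ⊥-elim (g tt)
T-injective {false} {false} _ _ = refl

T-allB⁻ : {A : Set} (p : A → Bool) (xs : List A) → T (allB p xs) → All (T ∘ p) xs
T-allB⁻ p []       _ = []
T-allB⁻ p (x ∷ xs) t = proj₁ pxs ∷ T-allB⁻ p xs (proj₂ pxs)
  where pxs = Equivalence.to (BoolP.T-∧ {p x} {allB p xs}) t

T-allB⁺ : {A : Set} (p : A → Bool) (xs : List A) → All (T ∘ p) xs → T (allB p xs)
T-allB⁺ p []       []         = tt
T-allB⁺ p (x ∷ xs) (px ∷ pxs) = Equivalence.from (BoolP.T-∧ {p x} {allB p xs}) (px , T-allB⁺ p xs pxs)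

toℕ-≡ᵇ-true : {n : ℕ} {a b : Fin n} → a ≡ b → (toℕ a ≡ᵇ toℕ b) ≡ true
toℕ-≡ᵇ-true {a = a} {b} a≡b = dec-true (toℕ a ℕ.≟ toℕ b) (cong toℕ a≡b)

toℕ-≡ᵇ-false : {n : ℕ} {a b : Fin n} → a ≢ b → (toℕ a ≡ᵇ toℕ b) ≡ false
toℕ-≡ᵇ-false {a = a} {b} a≢b = dec-false (toℕ a ℕ.≟ toℕ b) (a≢b ∘ FinP.toℕ-injective)

T-toℕ-≡ᵇ : {n : ℕ} {a b : Fin n} → T (toℕ a ≡ᵇ toℕ b) → a ≡ b
T-toℕ-≡ᵇ {a = a} {b} t = FinP.toℕ-injective (ℕP.≡ᵇ⇒≡ (toℕ a) (toℕ b) t)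

select : {A : Set} → (A → ℚ) → (A → ℚ) → Bool × A → ℚ
select f g (b , e) = if b then f e else g e

module _ {A : Set} where

  Πℚ-select-* : (H : List (Bool × A)) {f g f′ g′ f″ g″ : A → ℚ} →
                (∀ e → f e * f′ e ≡ f″ e) → (∀ e → g e * g′ e ≡ g″ e) →
                Πℚ H (select f g) * Πℚ H (select f′ g′) ≡ Πℚ H (select f″ g″)
  Πℚ-select-* H ff g′g = trans (sym (Πℚ-* H _ _)) (Πℚ-cong H λ where
    (true  , e) → ff e
    (false , e) → g′g e)

  ^-marked : (x : ℚ) (H : List (Bool × A)) → x ^ |E|of H ≡ Πℚ H (select (const x) (const 1ℚ))
  ^-marked x []              = refl
  ^-marked x ((true  , e) ∷ H) = cong (x *_) (^-marked x H)
  ^-marked x ((false , e) ∷ H) = trans (^-marked x H) (sym (ℚP.*-identityˡ _))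

  |E|of≤length : (H : List (Bool × A)) → |E|of H ℕ.≤ length H
  |E|of≤length []              = ℕ.z≤n
  |E|of≤length ((true  , e) ∷ H) = ℕ.s≤s (|E|of≤length H)
  |E|of≤length ((false , e) ∷ H) = ℕP.m≤n⇒m≤1+n (|E|of≤length H)

  ^-unmarked : (x : ℚ) (H : List (Bool × A)) →
               x ^ (length H ∸ |E|of H) ≡ Πℚ H (select (const 1ℚ) (const x))
  ^-unmarked x []              = refl
  ^-unmarked x ((true  , e) ∷ H) = trans (^-unmarked x H) (sym (ℚP.*-identityˡ _))
  ^-unmarked x ((false , e) ∷ H) = begin
    x ^ (suc (length H) ∸ |E|of H)   ≡⟨ cong (x ^_) (ℕP.+-∸-assoc 1 (|E|of≤length H)) ⟩
    x * x ^ (length H ∸ |E|of H)     ≡⟨ cong (x *_) (^-unmarked x H) ⟩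
    x * Πℚ H (select (const 1ℚ) (const x)) ∎
    where open ≡-Reasoning

  markings-length : (es : List A) → All (λ H → length H ≡ length es) (markings es)
  markings-length []       = refl ∷ []
  markings-length (e ∷ es) =
    AllP.concat⁺ (AllP.map⁺ (All.map (λ h → cong suc h ∷ cong suc h ∷ []) (markings-length es)))

  Σ-markings-Πℚ-select : (es : List A) (f g : A → ℚ) →
                         Σℚ (markings es) (λ H → Πℚ H (select f g)) ≡ Πℚ es (λ e → f e + g e)
  Σ-markings-Πℚ-select []       f g = ℚP.+-identityʳ 1ℚ
  Σ-markings-Πℚ-select (e ∷ es) f g = begin
    Σℚ (markings (e ∷ es)) (λ H → Πℚ H (select f g))
      ≡⟨ Σℚ-concatMap (λ H → ((true , e) ∷ H) ∷ ((false , e) ∷ H) ∷ []) (markings es) _ ⟩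
    Σℚ (markings es) (λ H → f e * Πℚ H (select f g) + (g e * Πℚ H (select f g) + 0ℚ))
      ≡⟨ Σℚ-cong (markings es) (λ H →
           solve 3 (λ a b p → a :* p :+ (b :* p :+ con 0ℚ) := (a :+ b) :* p) refl (f e) (g e) _) ⟩
    Σℚ (markings es) (λ H → (f e + g e) * Πℚ H (select f g))
      ≡⟨ Σℚ-*ˡ (markings es) (f e + g e) _ ⟩
    (f e + g e) * Σℚ (markings es) (λ H → Πℚ H (select f g))
      ≡⟨ cong ((f e + g e) *_) (Σ-markings-Πℚ-select es f g) ⟩
    (f e + g e) * Πℚ es (λ e → f e + g e) ∎
    where open ≡-Reasoning

  Σ-markings-expand : {C : Set} (es : List A) (cs : List C) (K : ℚ) (f g : C → A → ℚ)
                      (T : List (Bool × A) → ℚ) →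
    All (λ H → T H ≡ K * Σℚ cs (λ c → Πℚ H (select (f c) (g c)))) (markings es) →
    Σℚ (markings es) T ≡ K * Σℚ cs (λ c → Πℚ es (λ e → f c e + g c e))
  Σ-markings-expand es cs K f g T T≡ = begin
    Σℚ (markings es) T
      ≡⟨ Σℚ-congᴬ (markings es) T≡ ⟩
    Σℚ (markings es) (λ H → K * Σℚ cs (λ c → Πℚ H (select (f c) (g c))))
      ≡⟨ Σℚ-*ˡ (markings es) K _ ⟩
    K * Σℚ (markings es) (λ H → Σℚ cs (λ c → Πℚ H (select (f c) (g c))))
      ≡⟨ cong (K *_) (Σℚ-swap (markings es) cs _) ⟩
    K * Σℚ cs (λ c → Σℚ (markings es) (λ H → Πℚ H (select (f c) (g c))))
      ≡⟨ cong (K *_) (Σℚ-cong cs (λ c → Σ-markings-Πℚ-select es (f c) (g c))) ⟩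
    K * Σℚ cs (λ c → Πℚ es (λ e → f c e + g c e)) ∎
    where open ≡-Reasoning

Πℚ-subgraph : (G : Multigraph) (H : List (Bool × (Fin (n G) × Fin (n G)))) (f : Fin (n G) × Fin (n G) → ℚ) →
              Πℚ (edges (subgraph G H)) f ≡ Πℚ H (select f (const 1ℚ))
Πℚ-subgraph G []              f = refl
Πℚ-subgraph G ((true  , e) ∷ H) f = cong (f e *_) (Πℚ-subgraph G H f)
Πℚ-subgraph G ((false , e) ∷ H) f = trans (Πℚ-subgraph G H f) (sym (ℚP.*-identityˡ _))

Σℚ-allFin-suc : (n : ℕ) (g : Fin (suc n) → ℚ) → Σℚ (allFin (suc n)) g ≡ g zero + Σℚ (allFin n) (g ∘ suc)
Σℚ-allFin-suc n g = cong (g zero +_) (trans (cong (λ xs → Σℚ xs g) (sym (ListP.map-tabulate id suc)))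
                                              (Σℚ-map suc (allFin n) g))

Σℚ-allFin-δ : (q : ℕ) (a : Fin q) (g : Fin q → ℚ) →
              Σℚ (allFin q) (λ x → if toℕ a ≡ᵇ toℕ x then g x else 0ℚ) ≡ g a
Σℚ-allFin-δ (suc q) zero    g = begin
  Σℚ (allFin (suc q)) (λ x → if 0 ≡ᵇ toℕ x then g x else 0ℚ)
    ≡⟨ Σℚ-allFin-suc q (λ x → if 0 ≡ᵇ toℕ x then g x else 0ℚ) ⟩
  g zero + Σℚ (allFin q) (const 0ℚ)
    ≡⟨ cong (g zero +_) (Σℚ-zero (allFin q)) ⟩
  g zero + 0ℚ
    ≡⟨ ℚP.+-identityʳ (g zero) ⟩
  g zero ∎
  where open ≡-Reasoning
Σℚ-allFin-δ (suc q) (suc a) g = trans (Σℚ-allFin-suc q (λ x → if suc (toℕ a) ≡ᵇ toℕ x then g x else 0ℚ))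
  (trans (ℚP.+-identityˡ _) (Σℚ-allFin-δ q a (g ∘ suc)))

Σℚ-allFin-const : (n : ℕ) (c : ℚ) → Σℚ (allFin n) (const c) ≡ ℕ→ℚ n * c
Σℚ-allFin-const n c = trans (Σℚ-const (allFin n) c) (cong (λ l → ℕ→ℚ l * c) (ListP.length-tabulate {n = n} id))

Σℚ-allFin-nonzero-const : (n : ℕ) (b : Bool) →
  Σℚ (allFin (suc n)) (λ x → ind (not (toℕ x ≡ᵇ 0) ∧ b)) ≡ ℕ→ℚ n * ind b
Σℚ-allFin-nonzero-const n b = trans (Σℚ-allFin-suc n (λ x → ind (not (toℕ x ≡ᵇ 0) ∧ b)))
  (trans (ℚP.+-identityˡ _) (Σℚ-allFin-const n (ind b)))

Σℚ-allFin-nonzero : (n : ℕ) (b : Fin (suc n) → Bool) →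
  Σℚ (allFin (suc n)) (λ x → ind (not (toℕ x ≡ᵇ 0) ∧ b x)) ≡ Σℚ (allFin (suc n)) (ind ∘ b) + - ind (b zero)
Σℚ-allFin-nonzero n b = begin
  Σℚ (allFin (suc n)) (λ x → ind (not (toℕ x ≡ᵇ 0) ∧ b x))
    ≡⟨ Σℚ-allFin-suc n (λ x → ind (not (toℕ x ≡ᵇ 0) ∧ b x)) ⟩
  0ℚ + S
    ≡⟨ solve 2 (λ s c → con 0ℚ :+ s := (c :+ s) :+ (:- c)) refl S (ind (b zero)) ⟩
  (ind (b zero) + S) + - ind (b zero)
    ≡⟨ cong (_+ - ind (b zero)) (Σℚ-allFin-suc n (ind ∘ b)) ⟨
  Σℚ (allFin (suc n)) (ind ∘ b) + - ind (b zero) ∎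
  where
  open ≡-Reasoning
  S = Σℚ (allFin n) (ind ∘ b ∘ suc)

Σℚ-allVec-suc : (n q : ℕ) (h : Vec (Fin q) (suc n) → ℚ) →
                Σℚ (allVec (suc n) q) h ≡ Σℚ (allFin q) (λ x → Σℚ (allVec n q) (λ c → h (x ∷ c)))
Σℚ-allVec-suc n q h = trans (Σℚ-concatMap (λ x → map (x ∷_) (allVec n q)) (allFin q) h)
                            (Σℚ-cong (allFin q) (λ x → Σℚ-map (x ∷_) (allVec n q) h))

Σℚ-allVec-insertAt : (n q : ℕ) (v : Fin (suc n)) (h : Vec (Fin q) (suc n) → ℚ) →
  Σℚ (allVec (suc n) q) h ≡ Σℚ (allFin q) (λ x → Σℚ (allVec n q) (λ c → h (insertAt c v x)))
Σℚ-allVec-insertAt n       q zero    h = Σℚ-allVec-suc n q h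
Σℚ-allVec-insertAt (suc n) q (suc v) h = begin
  Σℚ (allVec (suc (suc n)) q) h
    ≡⟨ Σℚ-allVec-suc (suc n) q h ⟩
  Σℚ (allFin q) (λ y → Σℚ (allVec (suc n) q) (λ c → h (y ∷ c)))
    ≡⟨ Σℚ-cong (allFin q) (λ y → Σℚ-allVec-insertAt n q v (λ c → h (y ∷ c))) ⟩
  Σℚ (allFin q) (λ y → Σℚ (allFin q) (λ x → Σℚ (allVec n q) (λ c → h (y ∷ insertAt c v x))))
    ≡⟨ Σℚ-swap (allFin q) (allFin q) _ ⟩
  Σℚ (allFin q) (λ x → Σℚ (allFin q) (λ y → Σℚ (allVec n q) (λ c → h (y ∷ insertAt c v x))))
    ≡⟨ Σℚ-cong (allFin q) (λ x → sym (Σℚ-allVec-suc n q (λ c → h (insertAt c (suc v) x)))) ⟩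
  Σℚ (allFin q) (λ x → Σℚ (allVec (suc n) q) (λ c → h (insertAt c (suc v) x))) ∎
  where open ≡-Reasoning

Σℚ-allVec-1 : (m q : ℕ) → Σℚ (allVec m q) (const 1ℚ) ≡ ℕ→ℚ q ^ m
Σℚ-allVec-1 zero    q = ℚP.+-identityʳ 1ℚ
Σℚ-allVec-1 (suc m) q = begin
  Σℚ (allVec (suc m) q) (const 1ℚ)                ≡⟨ Σℚ-allVec-suc m q (const 1ℚ) ⟩
  Σℚ (allFin q) (λ _ → Σℚ (allVec m q) (const 1ℚ)) ≡⟨ Σℚ-cong (allFin q) (λ _ → Σℚ-allVec-1 m q) ⟩
  Σℚ (allFin q) (const (ℕ→ℚ q ^ m))                ≡⟨ Σℚ-allFin-const q (ℕ→ℚ q ^ m) ⟩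
  ℕ→ℚ q ^ suc m                                    ∎
  where open ≡-Reasoning

monochromatic : {m q : ℕ} → Vec (Fin q) m → Fin m × Fin m → Bool
monochromatic c (x , y) = toℕ (lookup c x) ≡ᵇ toℕ (lookup c y)

monochromatic-loop : {m q : ℕ} (c : Vec (Fin q) m) (u : Fin m) → monochromatic c (u , u) ≡ true
monochromatic-loop c u = toℕ-≡ᵇ-true {a = lookup c u} refl

pullback : {m m′ q : ℕ} → (Fin m → Fin m′) → Vec (Fin q) m′ → Vec (Fin q) m
pullback φ c = tabulate (lookup c ∘ φ)

monochromatic-pullback : {m m′ q : ℕ} (φ : Fin m → Fin m′) (c : Vec (Fin q) m′) (e : Fin m × Fin m) →
                         monochromatic (pullback φ c) e ≡ monochromatic c (mapEdge φ e)
monochromatic-pullback φ c (x , y) =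
  cong₂ (λ a b → toℕ a ≡ᵇ toℕ b) (VecP.lookup∘tabulate _ x) (VecP.lookup∘tabulate _ y)

-- The colourings that agree on u and v are the pullbacks of the colourings of the merged vertex set.
Σℚ-allVec-merge : (m q : ℕ) (u v : Fin (suc m)) (v≢u : v ≢ u) (h : Vec (Fin q) (suc m) → ℚ) →
  Σℚ (allVec (suc m) q) (λ c → if monochromatic c (u , v) then h c else 0ℚ)
    ≡ Σℚ (allVec m q) (h ∘ pullback (merge u v v≢u))
Σℚ-allVec-merge m q u v v≢u h = begin
  Σℚ (allVec (suc m) q) (λ c → if monochromatic c (u , v) then h c else 0ℚ)
    ≡⟨ Σℚ-allVec-insertAt m q v _ ⟩
  Σℚ (allFin q) (λ x → Σℚ (allVec m q) (λ c →
    if monochromatic (insertAt c v x) (u , v) then h (insertAt c v x) else 0ℚ))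
    ≡⟨ Σℚ-cong (allFin q) (λ x → Σℚ-cong (allVec m q) (λ c →
         cong (λ b → if b then h (insertAt c v x) else 0ℚ) (monochromatic-insertAt c x))) ⟩
  Σℚ (allFin q) (λ x → Σℚ (allVec m q) (λ c → if toℕ (lookup c u′) ≡ᵇ toℕ x then h (insertAt c v x) else 0ℚ))
    ≡⟨ Σℚ-swap (allFin q) (allVec m q) _ ⟩
  Σℚ (allVec m q) (λ c → Σℚ (allFin q) (λ x → if toℕ (lookup c u′) ≡ᵇ toℕ x then h (insertAt c v x) else 0ℚ))
    ≡⟨ Σℚ-cong (allVec m q) (λ c → Σℚ-allFin-δ q (lookup c u′) (h ∘ insertAt c v)) ⟩
  Σℚ (allVec m q) (λ c → h (insertAt c v (lookup c u′)))
    ≡⟨ Σℚ-cong (allVec m q) (λ c → cong h (insertAt-≡-pullback c)) ⟩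
  Σℚ (allVec m q) (h ∘ pullback (merge u v v≢u)) ∎
  where
  open ≡-Reasoning
  u′ = punchOut v≢u
  monochromatic-insertAt : ∀ c x → monochromatic (insertAt c v x) (u , v) ≡ (toℕ (lookup c u′) ≡ᵇ toℕ x)
  monochromatic-insertAt c x = cong₂ (λ a b → toℕ a ≡ᵇ toℕ b)
    (trans (cong (lookup (insertAt c v x)) (sym (FinP.punchIn-punchOut v≢u))) (VecP.insertAt-punchIn c v x u′))
    (VecP.insertAt-lookup c v x)
  insertAt-≡-pullback : ∀ c → insertAt c v (lookup c u′) ≡ pullback (merge u v v≢u) c
  insertAt-≡-pullback c = trans (sym (VecP.tabulate∘lookup _)) (VecP.tabulate-cong pointwise)
    where
    pointwise : ∀ w → lookup (insertAt c v (lookup c u′)) w ≡ lookup c (merge u v v≢u w)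
    pointwise w with w Fin.≟ v
    ... | yes refl = VecP.insertAt-lookup c v _
    ... | no w≢v   = trans (cong (lookup (insertAt c v _)) (sym (FinP.punchIn-punchOut (w≢v ∘ sym))))
                           (VecP.insertAt-punchIn c v _ _)

module Chromatic (q : ℕ) where

  Colouring : ℕ → Set
  Colouring m = Vec (Fin q) m

  bichromatic : {m : ℕ} → Colouring m → Fin m × Fin m → ℚ
  bichromatic c = ind ∘ not ∘ monochromatic c

  P-Σ-colourings : (G : Multigraph) → ℕ→ℚ (P G q) ≡ Σℚ (allVec (n G) q) (λ c → Πℚ (edges G) (bichromatic c))
  P-Σ-colourings G = trans (count-Σℚ (proper G) (allVec (n G) q))
                           (Σℚ-cong (allVec (n G) q) (λ c → allB-Πℚ _ (edges G)))

  -- A proper colouring of G/H is a colouring of G that is constant along the edges of H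
  -- and proper on the other edges.
  contractWeight : {m : ℕ} → Colouring m → Bool × (Fin m × Fin m) → ℚ
  contractWeight c = select (ind ∘ monochromatic c) (bichromatic c)

  P-contractAux : (k m : ℕ) (done : List (Fin m × Fin m)) (rest : Vec (Bool × (Fin m × Fin m)) k) →
    ℕ→ℚ (P (contractAux k m done rest) q)
      ≡ Σℚ (allVec m q) (λ c → Πℚ done (bichromatic c) * Πℚ (Vec.toList rest) (contractWeight c))
  P-contractAux zero m done [] =
    trans (P-Σ-colourings (mkG m done)) (Σℚ-cong (allVec m q) (λ c → sym (ℚP.*-identityʳ _)))
  P-contractAux (suc k) m done ((false , e) ∷ rest) = trans (P-contractAux k m (e ∷ done) rest)
    (Σℚ-cong (allVec m q) (λ c →
      solve 3 (λ a b c → (a :* b) :* c := b :* (a :* c)) refl (bichromatic c e) (Πℚ done (bichromatic c)) _))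
  P-contractAux (suc k) m done ((true , (u , v)) ∷ rest) with v Fin.≟ u
  ... | yes refl = trans (P-contractAux k m done rest) (Σℚ-cong (allVec m q) λ c →
        cong (Πℚ done (bichromatic c) *_) (sym (trans
          (cong (λ b → ind b * Πℚ (Vec.toList rest) (contractWeight c)) (monochromatic-loop c u))
          (ℚP.*-identityˡ _))))
  P-contractAux (suc k) (suc m) done ((true , (u , v)) ∷ rest) | no v≢u = begin
      ℕ→ℚ (P (contractAux k m (map (mapEdge φ) done) (Vec.map relabel rest)) q)
        ≡⟨ P-contractAux k m _ _ ⟩
      Σℚ (allVec m q) (λ c′ → Πℚ (map (mapEdge φ) done) (bichromatic c′)
                              * Πℚ (Vec.toList (Vec.map relabel rest)) (contractWeight c′))
        ≡⟨ Σℚ-cong (allVec m q) (λ c′ → cong₂ _*_ (done-pullback c′) (rest-pullback c′)) ⟩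
      Σℚ (allVec m q) (h ∘ pullback φ)
        ≡⟨ Σℚ-allVec-merge m q u v v≢u h ⟨
      Σℚ (allVec (suc m) q) (λ c → if monochromatic c (u , v) then h c else 0ℚ)
        ≡⟨ Σℚ-cong (allVec (suc m) q) (λ c → if-then-else-0 (monochromatic c (u , v)) (Πdone c) (Πrest c)) ⟩
      Σℚ (allVec (suc m) q) (λ c → Πdone c * (ind (monochromatic c (u , v)) * Πrest c)) ∎
    where
    open ≡-Reasoning
    φ = merge u v v≢u
    relabel : Bool × (Fin (suc m) × Fin (suc m)) → Bool × (Fin m × Fin m)
    relabel (b , e) = (b , mapEdge φ e)
    Πdone Πrest h : Colouring (suc m) → ℚ
    Πdone c = Πℚ done (bichromatic c)
    Πrest c = Πℚ (Vec.toList rest) (contractWeight c)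
    h c = Πdone c * Πrest c
    done-pullback : ∀ c′ → Πℚ (map (mapEdge φ) done) (bichromatic c′) ≡ Πdone (pullback φ c′)
    done-pullback c′ = trans (Πℚ-map (mapEdge φ) done _)
      (Πℚ-cong done (λ e → cong (ind ∘ not) (sym (monochromatic-pullback φ c′ e))))
    rest-pullback : ∀ c′ → Πℚ (Vec.toList (Vec.map relabel rest)) (contractWeight c′) ≡ Πrest (pullback φ c′)
    rest-pullback c′ = trans (cong (λ xs → Πℚ xs (contractWeight c′)) (VecP.toList-map relabel rest))
      (trans (Πℚ-map relabel (Vec.toList rest) _) (Πℚ-cong (Vec.toList rest) λ where
        (true  , e) → cong ind (sym (monochromatic-pullback φ c′ e))
        (false , e) → cong (ind ∘ not) (sym (monochromatic-pullback φ c′ e))))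
    if-then-else-0 : ∀ b x y → (if b then x * y else 0ℚ) ≡ x * (ind b * y)
    if-then-else-0 true  x y = cong (x *_) (sym (ℚP.*-identityˡ y))
    if-then-else-0 false x y = sym (trans (cong (x *_) (ℚP.*-zeroˡ y)) (ℚP.*-zeroʳ x))

  P-contract : (G : Multigraph) (H : List (Bool × (Fin (n G) × Fin (n G)))) →
               ℕ→ℚ (P (contract G H) q) ≡ Σℚ (allVec (n G) q) (λ c → Πℚ H (contractWeight c))
  P-contract G H = trans (P-contractAux (length H) (n G) [] (Vec.fromList H))
    (Σℚ-cong (allVec (n G) q) (λ c → trans (ℚP.*-identityˡ _)
      (cong (λ xs → Πℚ xs (contractWeight c)) (VecP.toList∘fromList H))))

δ : {k : ℕ} → Fin k → Fin k → ℕ → ℕ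
δ a w t = if toℕ a ≡ᵇ toℕ w then t else 0

δ-≡ : {k : ℕ} {a w : Fin k} (t : ℕ) → a ≡ w → δ a w t ≡ t
δ-≡ t a≡w = cong (λ b → if b then t else 0) (toℕ-≡ᵇ-true a≡w)

δ-≢ : {k : ℕ} {a w : Fin k} (t : ℕ) → a ≢ w → δ a w t ≡ 0
δ-≢ t a≢w = cong (λ b → if b then t else 0) (toℕ-≡ᵇ-false a≢w)

δ-0 : {k : ℕ} (a w : Fin k) → δ a w 0 ≡ 0
δ-0 a w with toℕ a ≡ᵇ toℕ w
... | true  = refl
... | false = refl

module Flows (q′ : ℕ) where

  q : ℕ
  q = suc q′

  open Chromatic q

  infix 4 _≈_ _≈ᵇ_

  record _≈_ (a b : ℕ) : Set where
    constructor mk≈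
    field %-≡ : a % q ≡ b % q
  open _≈_

  ≈-setoid : Setoid 0ℓ 0ℓ
  ≈-setoid = record
    { _≈_           = _≈_
    ; isEquivalence = record
      { refl  = mk≈ refl
      ; sym   = λ a≈b → mk≈ (sym (%-≡ a≈b))
      ; trans = λ a≈b b≈c → mk≈ (trans (%-≡ a≈b) (%-≡ b≈c))
      }
    }

  module ≈ = Setoid ≈-setoid
  module +CS = CommSemigroupProperties ℕP.+-commutativeSemigroup

  +-cong-≈ : {a b c d : ℕ} → a ≈ b → c ≈ d → a ℕ.+ c ≈ b ℕ.+ d
  +-cong-≈ {a} {b} {c} {d} (mk≈ a≈b) (mk≈ c≈d) = mk≈ (begin
    (a ℕ.+ c) % q            ≡⟨ %-distribˡ-+ a c q ⟩
    (a % q ℕ.+ c % q) % q    ≡⟨ cong₂ (λ x y → (x ℕ.+ y) % q) a≈b c≈d ⟩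
    (b % q ℕ.+ d % q) % q    ≡⟨ %-distribˡ-+ b d q ⟨
    (b ℕ.+ d) % q            ∎)
    where open ≡-Reasoning

  neg : ℕ → ℕ
  neg c = q ∸ c % q

  neg-inverse : (c : ℕ) → neg c ℕ.+ c ≈ 0
  neg-inverse c = mk≈ (begin
    (neg c ℕ.+ c) % q                                  ≡⟨ cong (λ t → (neg c ℕ.+ t) % q) (m≡m%n+[m/n]*n c q) ⟩
    (neg c ℕ.+ (c % q ℕ.+ (c ℕ./ q) ℕ.* q)) % q        ≡⟨ cong (_% q) (ℕP.+-assoc (neg c) (c % q) _) ⟨
    ((neg c ℕ.+ c % q) ℕ.+ (c ℕ./ q) ℕ.* q) % q        ≡⟨ [m+kn]%n≡m%n (neg c ℕ.+ c % q) (c ℕ./ q) q ⟩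
    (neg c ℕ.+ c % q) % q                              ≡⟨ cong (_% q) (ℕP.m∸n+n≡m (ℕP.<⇒≤ (m%n<n c q))) ⟩
    q % q                                              ≡⟨ n%n≡0 q ⟩
    0                                                  ∎)
    where open ≡-Reasoning

  +-cancelˡ-≈ : (c : ℕ) {a b : ℕ} → c ℕ.+ a ≈ c ℕ.+ b → a ≈ b
  +-cancelˡ-≈ c {a} {b} c+a≈c+b = begin
    a                         ≈⟨ +-cong-≈ (neg-inverse c) (≈.refl {a}) ⟨
    (neg c ℕ.+ c) ℕ.+ a       ≡⟨ ℕP.+-assoc (neg c) c a ⟩
    neg c ℕ.+ (c ℕ.+ a)       ≈⟨ +-cong-≈ (≈.refl {neg c}) c+a≈c+b ⟩
    neg c ℕ.+ (c ℕ.+ b)       ≡⟨ ℕP.+-assoc (neg c) c b ⟨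
    (neg c ℕ.+ c) ℕ.+ b       ≈⟨ +-cong-≈ (neg-inverse c) (≈.refl {b}) ⟩
    b                         ∎
    where open SetoidReasoning ≈-setoid

  <q-≈⇒≡ : {a b : ℕ} → a ℕ.< q → b ℕ.< q → a ≈ b → a ≡ b
  <q-≈⇒≡ a<q b<q (mk≈ a≈b) = trans (sym (m<n⇒m%n≡m a<q)) (trans a≈b (m<n⇒m%n≡m b<q))

  _≈ᵇ_ : ℕ → ℕ → Bool
  a ≈ᵇ b = a % q ≡ᵇ b % q

  T-≈ᵇ : {a b : ℕ} → T (a ≈ᵇ b) → a ≈ b
  T-≈ᵇ {a} {b} t = mk≈ (ℕP.≡ᵇ⇒≡ (a % q) (b % q) t)

  ≈⇒T-≈ᵇ : {a b : ℕ} → a ≈ b → T (a ≈ᵇ b)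
  ≈⇒T-≈ᵇ {a} {b} a≈b = ℕP.≡⇒≡ᵇ (a % q) (b % q) (%-≡ a≈b)

  ≈ᵇ-+-cancelˡ : (c a b : ℕ) → (c ℕ.+ a ≈ᵇ c ℕ.+ b) ≡ (a ≈ᵇ b)
  ≈ᵇ-+-cancelˡ c a b = T-injective
    (λ t → ≈⇒T-≈ᵇ (+-cancelˡ-≈ c (T-≈ᵇ {c ℕ.+ a} {c ℕ.+ b} t)))
    (λ t → ≈⇒T-≈ᵇ (+-cong-≈ (≈.refl {c}) (T-≈ᵇ {a} {b} t)))

  Σℚ-solutions : (a b : ℕ) → Σℚ (allFin q) (λ x → ind (a ≈ᵇ toℕ x ℕ.+ b)) ≡ 1ℚ
  Σℚ-solutions a b = trans (Σℚ-cong (allFin q) (cong ind ∘ solves⇔≡s)) (Σℚ-allFin-δ q s (const 1ℚ))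
    where
    open SetoidReasoning ≈-setoid
    s : Fin q
    s = Fin.fromℕ< (m%n<n (a ℕ.+ neg b) q)
    s-solves : a ≈ toℕ s ℕ.+ b
    s-solves = begin
      a                                ≡⟨ ℕP.+-identityʳ a ⟨
      a ℕ.+ 0                          ≈⟨ +-cong-≈ (≈.refl {a}) (neg-inverse b) ⟨
      a ℕ.+ (neg b ℕ.+ b)              ≡⟨ ℕP.+-assoc a (neg b) b ⟨
      (a ℕ.+ neg b) ℕ.+ b              ≈⟨ +-cong-≈ (mk≈ (m%n%n≡m%n (a ℕ.+ neg b) q)) (≈.refl {b}) ⟨
      (a ℕ.+ neg b) % q ℕ.+ b          ≡⟨ cong (ℕ._+ b) (FinP.toℕ-fromℕ< (m%n<n (a ℕ.+ neg b) q)) ⟨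
      toℕ s ℕ.+ b                      ∎
    unique : (x : Fin q) → a ≈ toℕ x ℕ.+ b → s ≡ x
    unique x a≈x+b = FinP.toℕ-injective (<q-≈⇒≡ (FinP.toℕ<n s) (FinP.toℕ<n x) (+-cancelˡ-≈ b (begin
      b ℕ.+ toℕ s     ≡⟨ ℕP.+-comm b (toℕ s) ⟩
      toℕ s ℕ.+ b     ≈⟨ s-solves ⟨
      a               ≈⟨ a≈x+b ⟩
      toℕ x ℕ.+ b     ≡⟨ ℕP.+-comm (toℕ x) b ⟩
      b ℕ.+ toℕ x     ∎)))
    solves⇔≡s : (x : Fin q) → (a ≈ᵇ toℕ x ℕ.+ b) ≡ (toℕ s ≡ᵇ toℕ x)
    solves⇔≡s x = T-injective
      (λ t → subst T (sym (toℕ-≡ᵇ-true (unique x (T-≈ᵇ {a} {toℕ x ℕ.+ b} t)))) tt)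
      (λ t → ≈⇒T-≈ᵇ (subst (λ y → a ≈ toℕ y ℕ.+ b) (T-toℕ-≡ᵇ t) s-solves))

  Labelled : ℕ → Set
  Labelled m = List (Fin q × (Fin m × Fin m))

  flowAt : {m : ℕ} → (Fin m × Fin m → Fin m) → Fin m → Labelled m → ℕ
  flowAt end w ps = sumℕ (map (λ p → δ (end (proj₂ p)) w (toℕ (proj₁ p))) ps)

  inflowAt outflowAt : {m : ℕ} → Fin m → Labelled m → ℕ
  inflowAt  = flowAt proj₂
  outflowAt = flowAt proj₁

  conserves : (m : ℕ) → Labelled m → Bool
  conserves m ps = allB (λ w → inflowAt w ps ≈ᵇ outflowAt w ps) (allFin m)

  Conserves : {m : ℕ} → Labelled m → Set
  Conserves ps = ∀ w → inflowAt w ps ≈ outflowAt w ps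

  T-conserves : {m : ℕ} (ps : Labelled m) → T (conserves m ps) → Conserves ps
  T-conserves {m} ps t w = T-≈ᵇ (AllP.tabulate⁻ (T-allB⁻ _ (allFin m) t) w)

  Conserves⇒T : {m : ℕ} (ps : Labelled m) → Conserves ps → T (conserves m ps)
  Conserves⇒T {m} ps c = T-allB⁺ _ (allFin m) (AllP.tabulate⁺ (≈⇒T-≈ᵇ ∘ c))

  nowhereZeroL : {m : ℕ} → Labelled m → Bool
  nowhereZeroL = allB (λ p → not (toℕ (proj₁ p) ≡ᵇ 0))

  labellings : {m : ℕ} → List (Fin m × Fin m) → List (Labelled m)
  labellings []      = [] ∷ []
  labellings (e ∷ L) = concatMap (λ x → map ((x , e) ∷_) (labellings L)) (allFin q)

  relabel : {m m′ : ℕ} → (Fin m → Fin m′) → Labelled m → Labelled m′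
  relabel φ = map (λ p → (proj₁ p , mapEdge φ (proj₂ p)))

  isNZFlowL : (m : ℕ) → Labelled m → Bool
  isNZFlowL m ps = nowhereZeroL ps ∧ conserves m ps

  flowCount : (m : ℕ) → List (Fin m × Fin m) → ℚ
  flowCount m L = Σℚ (labellings L) (ind ∘ isNZFlowL m)

  Σℚ-labellings-∷ : {m : ℕ} (e : Fin m × Fin m) (L : List (Fin m × Fin m)) (h : Labelled m → ℚ) →
    Σℚ (labellings (e ∷ L)) h ≡ Σℚ (allFin q) (λ x → Σℚ (labellings L) (λ ps → h ((x , e) ∷ ps)))
  Σℚ-labellings-∷ e L h = trans (Σℚ-concatMap (λ x → map ((x , e) ∷_) (labellings L)) (allFin q) h)
    (Σℚ-cong (allFin q) (λ x → Σℚ-map ((x , e) ∷_) (labellings L) h))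

  Σℚ-allVec-zip : {m : ℕ} (L : List (Fin m × Fin m)) (h : Labelled m → ℚ) →
    Σℚ (allVec (length L) q) (λ f → h (List.zip (Vec.toList f) L)) ≡ Σℚ (labellings L) h
  Σℚ-allVec-zip []      h = refl
  Σℚ-allVec-zip (e ∷ L) h = trans (Σℚ-allVec-suc (length L) q _)
    (trans (Σℚ-cong (allFin q) (λ x → Σℚ-allVec-zip L (λ ps → h ((x , e) ∷ ps))))
           (sym (Σℚ-labellings-∷ e L h)))

  Σℚ-labellings-map : {m m′ : ℕ} (φ : Fin m → Fin m′) (L : List (Fin m × Fin m)) (h : Labelled m′ → ℚ) →
    Σℚ (labellings (map (mapEdge φ) L)) h ≡ Σℚ (labellings L) (h ∘ relabel φ)
  Σℚ-labellings-map φ []      h = refl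
  Σℚ-labellings-map φ (e ∷ L) h = trans (Σℚ-labellings-∷ (mapEdge φ e) (map (mapEdge φ) L) h)
    (trans (Σℚ-cong (allFin q) (λ x → Σℚ-labellings-map φ L (λ ps → h ((x , mapEdge φ e) ∷ ps))))
           (sym (Σℚ-labellings-∷ e L (h ∘ relabel φ))))

  nowhereZero-zip : {m : ℕ} (L : List (Fin m × Fin m)) (f : Vec (Fin q) (length L)) →
                    nowhereZero (mkG m L) f ≡ nowhereZeroL (List.zip (Vec.toList f) L)
  nowhereZero-zip []      []      = refl
  nowhereZero-zip (e ∷ L) (x ∷ f) = cong (not (toℕ x ≡ᵇ 0) ∧_) (nowhereZero-zip L f)

  nowhereZeroL-relabel : {m m′ : ℕ} (φ : Fin m → Fin m′) (ps : Labelled m) →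
                         nowhereZeroL (relabel φ ps) ≡ nowhereZeroL ps
  nowhereZeroL-relabel φ []       = refl
  nowhereZeroL-relabel φ (p ∷ ps) = cong (not (toℕ (proj₁ p) ≡ᵇ 0) ∧_) (nowhereZeroL-relabel φ ps)

  F≡flowCount : (m : ℕ) (L : List (Fin m × Fin m)) → ℕ→ℚ (F (mkG m L) q) ≡ flowCount m L
  F≡flowCount m L = begin
    ℕ→ℚ (F (mkG m L) q)
      ≡⟨ count-Σℚ (isNZFlow (mkG m L)) (allVec (length L) q) ⟩
    Σℚ (allVec (length L) q) (ind ∘ isNZFlow (mkG m L))
      ≡⟨ Σℚ-cong (allVec (length L) q) (λ f →
           cong (λ b → ind (b ∧ conserves m (zipped f))) (nowhereZero-zip L f)) ⟩
    Σℚ (allVec (length L) q) (ind ∘ isNZFlowL m ∘ zipped)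
      ≡⟨ Σℚ-allVec-zip L (ind ∘ isNZFlowL m) ⟩
    flowCount m L ∎
    where
    open ≡-Reasoning
    zipped : Vec (Fin q) (length L) → Labelled m
    zipped f = List.zip (Vec.toList f) L

  nonzero : Fin q → Bool
  nonzero x = not (toℕ x ≡ᵇ 0)

  flowCount-∷ : (m : ℕ) (e : Fin m × Fin m) (L : List (Fin m × Fin m)) →
    flowCount m (e ∷ L)
      ≡ Σℚ (labellings L) (λ ps → Σℚ (allFin q) (λ x →
          ind (nonzero x ∧ (nowhereZeroL ps ∧ conserves m ((x , e) ∷ ps)))))
  flowCount-∷ m e L = trans (Σℚ-labellings-∷ e L (ind ∘ isNZFlowL m))
    (trans (Σℚ-swap (allFin q) (labellings L) _)
    (Σℚ-cong (labellings L) (λ ps → Σℚ-cong (allFin q) (λ x → cong ind (BoolP.∧-assoc (nonzero x) _ _)))))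

  module Contraction {m : ℕ} (u v : Fin (suc m)) (v≢u : v ≢ u) where

    φ : Fin (suc m) → Fin m
    φ = merge u v v≢u

    u≢v : u ≢ v
    u≢v = v≢u ∘ sym

    merge-≢ : (b : Fin (suc m)) (b≢v : b ≢ v) → φ b ≡ punchOut (b≢v ∘ sym)
    merge-≢ b b≢v with b Fin.≟ v
    ... | yes b≡v = ⊥-elim (b≢v b≡v)
    ... | no _    = FinP.punchOut-cong v refl

    merge-v : φ v ≡ φ u
    merge-v with v Fin.≟ v
    ... | yes _   = trans (FinP.punchOut-cong v refl) (sym (merge-≢ u u≢v))
    ... | no v≢v  = ⊥-elim (v≢v refl)

    merge-injective : {b w : Fin (suc m)} → b ≢ v → w ≢ v → φ b ≡ φ w → b ≡ w
    merge-injective {b} {w} b≢v w≢v φb≡φw = FinP.punchOut-injective (b≢v ∘ sym) (w≢v ∘ sym)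
      (trans (sym (merge-≢ b b≢v)) (trans φb≡φw (merge-≢ w w≢v)))

    merge-punchIn : (w : Fin m) → φ (punchIn v w) ≡ w
    merge-punchIn w = trans (merge-≢ (punchIn v w) (FinP.punchInᵢ≢i v w))
      (trans (FinP.punchOut-cong v refl) (FinP.punchOut-punchIn v))

    δ-merge-other : (b w : Fin (suc m)) (t : ℕ) → w ≢ u → w ≢ v → δ (φ b) (φ w) t ≡ δ b w t
    δ-merge-other b w t w≢u w≢v with b Fin.≟ w
    ... | yes b≡w = trans (δ-≡ t (cong φ b≡w)) (sym (δ-≡ t b≡w))
    ... | no b≢w  = trans (δ-≢ t (φb≢φw (b Fin.≟ v))) (sym (δ-≢ t b≢w))
      where
      φb≢φw : Dec (b ≡ v) → φ b ≢ φ w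
      φb≢φw (yes b≡v) φb≡φw =
        w≢u (sym (merge-injective u≢v w≢v (trans (sym merge-v) (trans (cong φ (sym b≡v)) φb≡φw))))
      φb≢φw (no b≢v)  φb≡φw = b≢w (merge-injective b≢v w≢v φb≡φw)

    δ-merge-merged : (b : Fin (suc m)) (t : ℕ) → δ (φ b) (φ u) t ≡ δ b u t ℕ.+ δ b v t
    δ-merge-merged b t = cases (b Fin.≟ u) (b Fin.≟ v)
      where
      cases : Dec (b ≡ u) → Dec (b ≡ v) → δ (φ b) (φ u) t ≡ δ b u t ℕ.+ δ b v t
      cases (yes b≡u) _         = trans (δ-≡ t (cong φ b≡u)) (sym (trans
        (cong₂ ℕ._+_ (δ-≡ t b≡u) (δ-≢ t (u≢v ∘ trans (sym b≡u)))) (ℕP.+-identityʳ t)))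
      cases (no b≢u)  (yes b≡v) = trans (δ-≡ t (trans (cong φ b≡v) merge-v))
        (sym (cong₂ ℕ._+_ (δ-≢ t b≢u) (δ-≡ t b≡v)))
      cases (no b≢u)  (no b≢v)  = trans (δ-≢ t (b≢u ∘ merge-injective b≢v u≢v))
        (sym (cong₂ ℕ._+_ (δ-≢ t b≢u) (δ-≢ t b≢v)))

    module _ (end : ∀ {k} → Fin k × Fin k → Fin k)
             (end-mapEdge : ∀ e → end (mapEdge φ e) ≡ φ (end e)) where

      flowAt-relabel-other : (w : Fin (suc m)) → w ≢ u → w ≢ v → (ps : Labelled (suc m)) →
                             flowAt end (φ w) (relabel φ ps) ≡ flowAt end w ps
      flowAt-relabel-other w w≢u w≢v []             = refl
      flowAt-relabel-other w w≢u w≢v ((x , e) ∷ ps) = cong₂ ℕ._+_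
        (trans (cong (λ a → δ a (φ w) (toℕ x)) (end-mapEdge e)) (δ-merge-other (end e) w (toℕ x) w≢u w≢v))
        (flowAt-relabel-other w w≢u w≢v ps)

      flowAt-relabel-merged : (ps : Labelled (suc m)) →
                              flowAt end (φ u) (relabel φ ps) ≡ flowAt end u ps ℕ.+ flowAt end v ps
      flowAt-relabel-merged []             = refl
      flowAt-relabel-merged ((x , e) ∷ ps) = trans
        (cong₂ ℕ._+_ (trans (cong (λ a → δ a (φ u) (toℕ x)) (end-mapEdge e)) (δ-merge-merged (end e) (toℕ x)))
                     (flowAt-relabel-merged ps))
        (+CS.interchange (δ (end e) u (toℕ x)) (δ (end e) v (toℕ x)) (flowAt end u ps) (flowAt end v ps))

    module _ (x : Fin q) (ps : Labelled (suc m)) where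

      private
        X : ℕ
        X = toℕ x
        I O : Fin (suc m) → ℕ
        I w = inflowAt w ps
        O w = outflowAt w ps
        ps′ : Labelled m
        ps′ = relabel φ ps

        in-merged : inflowAt (φ u) ps′ ≡ I u ℕ.+ I v
        in-merged = flowAt-relabel-merged proj₂ (λ _ → refl) ps
        out-merged : outflowAt (φ u) ps′ ≡ O u ℕ.+ O v
        out-merged = flowAt-relabel-merged proj₁ (λ _ → refl) ps
        in-other : (w : Fin (suc m)) → w ≢ u → w ≢ v → inflowAt (φ w) ps′ ≡ I w
        in-other w w≢u w≢v = flowAt-relabel-other proj₂ (λ _ → refl) w w≢u w≢v ps
        out-other : (w : Fin (suc m)) → w ≢ u → w ≢ v → outflowAt (φ w) ps′ ≡ O w
        out-other w w≢u w≢v = flowAt-relabel-other proj₁ (λ _ → refl) w w≢u w≢v ps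

        Balanced : Fin (suc m) → Set
        Balanced w = δ v w X ℕ.+ I w ≈ δ u w X ℕ.+ O w

        balanced⇒ : (w : Fin (suc m)) {a b : ℕ} → δ v w X ≡ a → δ u w X ≡ b →
                    Balanced w → a ℕ.+ I w ≈ b ℕ.+ O w
        balanced⇒ w = subst₂ (λ a b → a ℕ.+ I w ≈ b ℕ.+ O w)

        ⇒balanced : (w : Fin (suc m)) {a b : ℕ} → δ v w X ≡ a → δ u w X ≡ b →
                    a ℕ.+ I w ≈ b ℕ.+ O w → Balanced w
        ⇒balanced w δv δu = subst₂ (λ a b → a ℕ.+ I w ≈ b ℕ.+ O w) (sym δv) (sym δu)

      Conserves-contract⁻ : Conserves ((x , (u , v)) ∷ ps) → Conserves ps′ × I u ≈ X ℕ.+ O u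
      Conserves-contract⁻ conserved = conserved′ , at-u
        where
        open SetoidReasoning ≈-setoid
        at-u : I u ≈ X ℕ.+ O u
        at-u = balanced⇒ u (δ-≢ X v≢u) (δ-≡ {a = u} X refl) (conserved u)
        at-v : X ℕ.+ I v ≈ O v
        at-v = balanced⇒ v (δ-≡ {a = v} X refl) (δ-≢ X u≢v) (conserved v)
        merged : inflowAt (φ u) ps′ ≈ outflowAt (φ u) ps′
        merged = begin
          inflowAt (φ u) ps′  ≡⟨ in-merged ⟩
          I u ℕ.+ I v         ≈⟨ +-cancelˡ-≈ X (begin
            X ℕ.+ (I u ℕ.+ I v)       ≡⟨ +CS.x∙yz≈y∙xz X (I u) (I v) ⟩
            I u ℕ.+ (X ℕ.+ I v)       ≈⟨ +-cong-≈ at-u at-v ⟩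
            (X ℕ.+ O u) ℕ.+ O v       ≡⟨ ℕP.+-assoc X (O u) (O v) ⟩
            X ℕ.+ (O u ℕ.+ O v)       ∎) ⟩
          O u ℕ.+ O v         ≡⟨ out-merged ⟨
          outflowAt (φ u) ps′ ∎
        at-merge : (w : Fin (suc m)) → w ≢ v → Dec (w ≡ u) → inflowAt (φ w) ps′ ≈ outflowAt (φ w) ps′
        at-merge w w≢v (yes w≡u) = subst (λ z → inflowAt (φ z) ps′ ≈ outflowAt (φ z) ps′) (sym w≡u) merged
        at-merge w w≢v (no w≢u)  = begin
          inflowAt (φ w) ps′   ≡⟨ in-other w w≢u w≢v ⟩
          I w                  ≈⟨ balanced⇒ w (δ-≢ X (w≢v ∘ sym)) (δ-≢ X (w≢u ∘ sym)) (conserved w) ⟩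
          O w                  ≡⟨ out-other w w≢u w≢v ⟨
          outflowAt (φ w) ps′  ∎
        conserved′ : Conserves ps′
        conserved′ w′ = subst (λ z → inflowAt z ps′ ≈ outflowAt z ps′) (merge-punchIn w′)
          (at-merge (punchIn v w′) (FinP.punchInᵢ≢i v w′) (punchIn v w′ Fin.≟ u))

      Conserves-contract⁺ : Conserves ps′ → I u ≈ X ℕ.+ O u → Conserves ((x , (u , v)) ∷ ps)
      Conserves-contract⁺ conserved′ at-u w = cases (w Fin.≟ v) (w Fin.≟ u)
        where
        open SetoidReasoning ≈-setoid
        merged : I u ℕ.+ I v ≈ O u ℕ.+ O v
        merged = begin
          I u ℕ.+ I v          ≡⟨ in-merged ⟨
          inflowAt (φ u) ps′   ≈⟨ conserved′ (φ u) ⟩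
          outflowAt (φ u) ps′  ≡⟨ out-merged ⟩
          O u ℕ.+ O v          ∎
        at-v : X ℕ.+ I v ≈ O v
        at-v = +-cancelˡ-≈ (O u) (begin
          O u ℕ.+ (X ℕ.+ I v)   ≡⟨ +CS.x∙yz≈yx∙z (O u) X (I v) ⟩
          (X ℕ.+ O u) ℕ.+ I v   ≈⟨ +-cong-≈ at-u (≈.refl {I v}) ⟨
          I u ℕ.+ I v           ≈⟨ merged ⟩
          O u ℕ.+ O v           ∎)
        cases : Dec (w ≡ v) → Dec (w ≡ u) → Balanced w
        cases (yes w≡v) _         =
          subst Balanced (sym w≡v) (⇒balanced v (δ-≡ {a = v} X refl) (δ-≢ X u≢v) at-v)
        cases (no w≢v)  (yes w≡u) =
          subst Balanced (sym w≡u) (⇒balanced u (δ-≢ X v≢u) (δ-≡ {a = u} X refl) at-u)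
        cases (no w≢v)  (no w≢u)  = ⇒balanced w (δ-≢ X (w≢v ∘ sym)) (δ-≢ X (w≢u ∘ sym)) (begin
          I w                  ≡⟨ in-other w w≢u w≢v ⟨
          inflowAt (φ w) ps′   ≈⟨ conserved′ (φ w) ⟩
          outflowAt (φ w) ps′  ≡⟨ out-other w w≢u w≢v ⟩
          O w                  ∎)

      conserves-contract :
        conserves (suc m) ((x , (u , v)) ∷ ps) ≡ conserves m ps′ ∧ (I u ≈ᵇ X ℕ.+ O u)
      conserves-contract = T-injective
        (λ t → let (conserved′ , at-u) = Conserves-contract⁻ (T-conserves ((x , (u , v)) ∷ ps) t)
               in Equivalence.from (BoolP.T-∧ {conserves m ps′}) (Conserves⇒T ps′ conserved′ , ≈⇒T-≈ᵇ at-u))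
        (λ t → let (t′ , t-u) = Equivalence.to (BoolP.T-∧ {conserves m ps′}) t
               in Conserves⇒T ((x , (u , v)) ∷ ps) (Conserves-contract⁺ (T-conserves ps′ t′) (T-≈ᵇ t-u)))

  conserves-loop : {m : ℕ} (x : Fin q) (u : Fin m) (ps : Labelled m) →
                   conserves m ((x , (u , u)) ∷ ps) ≡ conserves m ps
  conserves-loop {m} x u ps =
    allB-cong (allFin m) (λ w → ≈ᵇ-+-cancelˡ (δ u w (toℕ x)) (inflowAt w ps) (outflowAt w ps))

  conserves-zero : {m : ℕ} (e : Fin m × Fin m) (ps : Labelled m) →
                   conserves m ((zero , e) ∷ ps) ≡ conserves m ps
  conserves-zero {m} (a , b) ps = allB-cong (allFin m) (λ w →
    cong₂ (λ i o → i ℕ.+ inflowAt w ps ≈ᵇ o ℕ.+ outflowAt w ps) (δ-0 b w) (δ-0 a w))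

  flowCount-loop : (m : ℕ) (u : Fin m) (L : List (Fin m × Fin m)) →
                   flowCount m ((u , u) ∷ L) ≡ ℕ→ℚ q′ * flowCount m L
  flowCount-loop m u L = begin
    flowCount m ((u , u) ∷ L)
      ≡⟨ flowCount-∷ m (u , u) L ⟩
    Σℚ (labellings L) (λ ps → Σℚ (allFin q) (λ x →
      ind (nonzero x ∧ (nowhereZeroL ps ∧ conserves m ((x , (u , u)) ∷ ps)))))
      ≡⟨ Σℚ-cong (labellings L) (λ ps → Σℚ-cong (allFin q) (λ x →
           cong (λ b → ind (nonzero x ∧ (nowhereZeroL ps ∧ b))) (conserves-loop x u ps))) ⟩
    Σℚ (labellings L) (λ ps → Σℚ (allFin q) (λ x → ind (nonzero x ∧ isNZFlowL m ps)))
      ≡⟨ Σℚ-cong (labellings L) (λ ps → Σℚ-allFin-nonzero-const q′ (isNZFlowL m ps)) ⟩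
    Σℚ (labellings L) (λ ps → ℕ→ℚ q′ * ind (isNZFlowL m ps))
      ≡⟨ Σℚ-*ˡ (labellings L) (ℕ→ℚ q′) _ ⟩
    ℕ→ℚ q′ * flowCount m L ∎
    where open ≡-Reasoning

  flowCount-deletion-contraction : (m : ℕ) (u v : Fin (suc m)) (v≢u : v ≢ u) →
    (L : List (Fin (suc m) × Fin (suc m))) →
    flowCount (suc m) ((u , v) ∷ L) ≡ flowCount m (map (mapEdge (merge u v v≢u)) L) + - flowCount (suc m) L
  flowCount-deletion-contraction m u v v≢u L = begin
    flowCount (suc m) ((u , v) ∷ L)
      ≡⟨ flowCount-∷ (suc m) (u , v) L ⟩
    Σℚ (labellings L) (λ ps → Σℚ (allFin q) (λ x → ind (nonzero x ∧ B x ps)))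
      ≡⟨ Σℚ-cong (labellings L) (λ ps → Σℚ-allFin-nonzero q′ (λ x → B x ps)) ⟩
    Σℚ (labellings L) (λ ps → Σℚ (allFin q) (λ x → ind (B x ps)) + - ind (B zero ps))
      ≡⟨ Σℚ-cong (labellings L) (λ ps → cong₂ (λ a b → a + - b) (Σ-contracted ps)
           (cong (λ b → ind (nowhereZeroL ps ∧ b)) (conserves-zero (u , v) ps))) ⟩
    Σℚ (labellings L) (λ ps → ind (isNZFlowL m (relabel φ ps)) + - ind (isNZFlowL (suc m) ps))
      ≡⟨ trans (Σℚ-+ (labellings L) (ind ∘ isNZFlowL m ∘ relabel φ) (λ ps → - ind (isNZFlowL (suc m) ps)))
               (cong (Σℚ (labellings L) (ind ∘ isNZFlowL m ∘ relabel φ) +_)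
                     (Σℚ-neg (labellings L) (ind ∘ isNZFlowL (suc m)))) ⟩
    Σℚ (labellings L) (ind ∘ isNZFlowL m ∘ relabel φ) + - flowCount (suc m) L
      ≡⟨ cong (_+ - flowCount (suc m) L) (Σℚ-labellings-map φ L (ind ∘ isNZFlowL m)) ⟨
    flowCount m (map (mapEdge φ) L) + - flowCount (suc m) L ∎
    where
    open ≡-Reasoning
    open Contraction u v v≢u using (φ; conserves-contract)
    B : Fin q → Labelled (suc m) → Bool
    B x ps = nowhereZeroL ps ∧ conserves (suc m) ((x , (u , v)) ∷ ps)
    Σ-contracted : (ps : Labelled (suc m)) →
                   Σℚ (allFin q) (λ x → ind (B x ps)) ≡ ind (isNZFlowL m (relabel φ ps))
    Σ-contracted ps = begin
      Σℚ (allFin q) (λ x → ind (B x ps))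
        ≡⟨ Σℚ-cong (allFin q) (λ x → trans (cong (λ b → ind (nowhereZeroL ps ∧ b)) (conserves-contract x ps))
             (trans (cong ind (sym (BoolP.∧-assoc (nowhereZeroL ps) _ _))) (ind-∧ (nowhereZeroL ps ∧ _) _))) ⟩
      Σℚ (allFin q) (λ x → b′ * ind (inflowAt u ps ≈ᵇ toℕ x ℕ.+ outflowAt u ps))
        ≡⟨ Σℚ-*ˡ (allFin q) b′ _ ⟩
      b′ * Σℚ (allFin q) (λ x → ind (inflowAt u ps ≈ᵇ toℕ x ℕ.+ outflowAt u ps))
        ≡⟨ cong (b′ *_) (Σℚ-solutions (inflowAt u ps) (outflowAt u ps)) ⟩
      b′ * 1ℚ
        ≡⟨ ℚP.*-identityʳ b′ ⟩
      b′
        ≡⟨ cong (λ b → ind (b ∧ conserves m (relabel φ ps))) (nowhereZeroL-relabel φ ps) ⟨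
      ind (isNZFlowL m (relabel φ ps)) ∎
      where b′ = ind (nowhereZeroL ps ∧ conserves m (relabel φ ps))

  flowWeight : Bool → ℚ
  flowWeight b = if b then ℕ→ℚ q′ else - 1ℚ

  colourSum : (m : ℕ) → List (Fin m × Fin m) → ℚ
  colourSum m L = Σℚ (allVec m q) (λ c → Πℚ L (flowWeight ∘ monochromatic c))

  colourSum-loop : (m : ℕ) (u : Fin m) (L : List (Fin m × Fin m)) →
                   colourSum m ((u , u) ∷ L) ≡ ℕ→ℚ q′ * colourSum m L
  colourSum-loop m u L = trans
    (Σℚ-cong (allVec m q) (λ c →
      cong (λ b → flowWeight b * Πℚ L (flowWeight ∘ monochromatic c)) (monochromatic-loop c u)))
    (Σℚ-*ˡ (allVec m q) (ℕ→ℚ q′) _)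

  colourSum-deletion-contraction : (m : ℕ) (u v : Fin (suc m)) (v≢u : v ≢ u) →
    (L : List (Fin (suc m) × Fin (suc m))) →
    colourSum (suc m) ((u , v) ∷ L)
      ≡ ℕ→ℚ q * colourSum m (map (mapEdge (merge u v v≢u)) L) + - colourSum (suc m) L
  colourSum-deletion-contraction m u v v≢u L = begin
    colourSum (suc m) ((u , v) ∷ L)
      ≡⟨ Σℚ-cong (allVec (suc m) q) (λ c → flowWeight-split (monochromatic c (u , v)) (Π c)) ⟩
    Σℚ (allVec (suc m) q) (λ c → (if monochromatic c (u , v) then ℕ→ℚ q * Π c else 0ℚ) + - Π c)
      ≡⟨ Σℚ-+ (allVec (suc m) q) _ _ ⟩
    Σℚ (allVec (suc m) q) (λ c → if monochromatic c (u , v) then ℕ→ℚ q * Π c else 0ℚ)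
      + Σℚ (allVec (suc m) q) (λ c → - Π c)
      ≡⟨ cong₂ _+_ (Σℚ-allVec-merge m q u v v≢u (λ c → ℕ→ℚ q * Π c)) (Σℚ-neg (allVec (suc m) q) Π) ⟩
    Σℚ (allVec m q) (λ c′ → ℕ→ℚ q * Π (pullback φ c′)) + - colourSum (suc m) L
      ≡⟨ cong (_+ - colourSum (suc m) L) (trans (Σℚ-*ˡ (allVec m q) (ℕ→ℚ q) _)
           (cong (ℕ→ℚ q *_) (Σℚ-cong (allVec m q) Π-pullback))) ⟩
    ℕ→ℚ q * colourSum m (map (mapEdge φ) L) + - colourSum (suc m) L ∎
    where
    open ≡-Reasoning
    φ = merge u v v≢u
    Π : Vec (Fin q) (suc m) → ℚ
    Π c = Πℚ L (flowWeight ∘ monochromatic c)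
    flowWeight-split : (b : Bool) (y : ℚ) → flowWeight b * y ≡ (if b then ℕ→ℚ q * y else 0ℚ) + - y
    flowWeight-split true  y = trans (solve 2 (λ k y → k :* y := (con 1ℚ :+ k) :* y :+ (:- y)) refl (ℕ→ℚ q′) y)
                                     (cong (λ Q → Q * y + - y) (sym (ℕ→ℚ-suc q′)))
    flowWeight-split false y = solve 1 (λ y → (:- con 1ℚ) :* y := con 0ℚ :+ (:- y)) refl y
    Π-pullback : ∀ c′ → Π (pullback φ c′) ≡ Πℚ (map (mapEdge φ) L) (flowWeight ∘ monochromatic c′)
    Π-pullback c′ = trans (Πℚ-cong L (λ e → cong flowWeight (monochromatic-pullback φ c′ e)))
                          (sym (Πℚ-map (mapEdge φ) L (flowWeight ∘ monochromatic c′)))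

  -- Both sides obey the same deletion–contraction recursion; len bounds the recursion depth.
  flowCount-colourSum : (len m : ℕ) (L : List (Fin m × Fin m)) → length L ≡ len →
                        ℕ→ℚ q ^ m * flowCount m L ≡ colourSum m L
  flowCount-colourSum len m [] _ = begin
    ℕ→ℚ q ^ m * (ind (conserves m []) + 0ℚ)  ≡⟨ cong (λ b → ℕ→ℚ q ^ m * (ind b + 0ℚ)) conserves-[] ⟩
    ℕ→ℚ q ^ m * (1ℚ + 0ℚ)                    ≡⟨ ℚP.*-identityʳ (ℕ→ℚ q ^ m) ⟩
    ℕ→ℚ q ^ m                                ≡⟨ Σℚ-allVec-1 m q ⟨
    colourSum m []                           ∎
    where
    open ≡-Reasoning
    conserves-[] : conserves m [] ≡ true
    conserves-[] = Equivalence.to BoolP.T-≡ (Conserves⇒T {m} [] (λ _ → ≈.refl))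
  flowCount-colourSum (suc len) m ((u , v) ∷ L) ∣L∣≡len with v Fin.≟ u
  ... | yes refl = begin
    ℕ→ℚ q ^ m * flowCount m ((u , u) ∷ L)
      ≡⟨ cong (ℕ→ℚ q ^ m *_) (flowCount-loop m u L) ⟩
    ℕ→ℚ q ^ m * (ℕ→ℚ q′ * flowCount m L)
      ≡⟨ solve 3 (λ a b c → a :* (b :* c) := b :* (a :* c)) refl (ℕ→ℚ q ^ m) (ℕ→ℚ q′) (flowCount m L) ⟩
    ℕ→ℚ q′ * (ℕ→ℚ q ^ m * flowCount m L)
      ≡⟨ cong (ℕ→ℚ q′ *_) (flowCount-colourSum len m L (ℕP.suc-injective ∣L∣≡len)) ⟩
    ℕ→ℚ q′ * colourSum m L
      ≡⟨ colourSum-loop m u L ⟨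
    colourSum m ((u , u) ∷ L) ∎
    where open ≡-Reasoning
  flowCount-colourSum (suc len) (suc m) ((u , v) ∷ L) ∣L∣≡len | no v≢u = begin
    Q ^ suc m * flowCount (suc m) ((u , v) ∷ L)
      ≡⟨ cong (Q ^ suc m *_) (flowCount-deletion-contraction m u v v≢u L) ⟩
    Q ^ suc m * (flowCount m L′ + - flowCount (suc m) L)
      ≡⟨ solve 4 (λ Q Qᵐ a b → (Q :* Qᵐ) :* (a :+ (:- b)) := Q :* (Qᵐ :* a) :+ (:- ((Q :* Qᵐ) :* b)))
           refl Q (Q ^ m) (flowCount m L′) (flowCount (suc m) L) ⟩
    Q * (Q ^ m * flowCount m L′) + - (Q ^ suc m * flowCount (suc m) L)
      ≡⟨ cong₂ (λ a b → Q * a + - b) (flowCount-colourSum len m L′ (trans (ListP.length-map _ L) ∣L∣≡len′))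
                                     (flowCount-colourSum len (suc m) L ∣L∣≡len′) ⟩
    Q * colourSum m L′ + - colourSum (suc m) L
      ≡⟨ colourSum-deletion-contraction m u v v≢u L ⟨
    colourSum (suc m) ((u , v) ∷ L) ∎
    where
    open ≡-Reasoning
    Q = ℕ→ℚ q
    L′ = map (mapEdge (merge u v v≢u)) L
    ∣L∣≡len′ : length L ≡ len
    ∣L∣≡len′ = ℕP.suc-injective ∣L∣≡len

  F-colourSum : (G : Multigraph) → ℕ→ℚ (F G q) * ℕ→ℚ q ^ n G ≡ colourSum (n G) (edges G)
  F-colourSum G = begin
    ℕ→ℚ (F G q) * ℕ→ℚ q ^ n G          ≡⟨ ℚP.*-comm (ℕ→ℚ (F G q)) (ℕ→ℚ q ^ n G) ⟩
    ℕ→ℚ q ^ n G * ℕ→ℚ (F G q)          ≡⟨ cong (ℕ→ℚ q ^ n G *_) (F≡flowCount (n G) (edges G)) ⟩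
    ℕ→ℚ q ^ n G * flowCount (n G) (edges G) ≡⟨ flowCount-colourSum (|E| G) (n G) (edges G) refl ⟩
    colourSum (n G) (edges G)          ∎
    where open ≡-Reasoning

module Identities (k : ℕ) where

  open Flows (suc k)
  open Chromatic q

  -- 1/(q - 1); ζ₋₁ k is - recip by definition
  recip : ℚ
  recip = ℤ.+ 1 / suc k

  recip-*-q-1 : recip * ℕ→ℚ (suc k) ≡ 1ℚ
  recip-*-q-1 = trans (ℚP.*-comm recip (ℕ→ℚ (suc k))) (ℕ→ℚ-*-recip k)

  inv^-*-q^ : (m : ℕ) → inv k ^ m * ℕ→ℚ q ^ m ≡ 1ℚ
  inv^-*-q^ zero    = refl
  inv^-*-q^ (suc m) = begin
    (inv k * inv k ^ m) * (ℕ→ℚ q * ℕ→ℚ q ^ m)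
      ≡⟨ solve 4 (λ a b c d → (a :* b) :* (c :* d) := (c :* a) :* (b :* d))
               refl (inv k) (inv k ^ m) (ℕ→ℚ q) (ℕ→ℚ q ^ m) ⟩
    (ℕ→ℚ q * inv k) * (inv k ^ m * ℕ→ℚ q ^ m)
      ≡⟨ cong₂ _*_ (ℕ→ℚ-*-recip (suc k)) (inv^-*-q^ m) ⟩
    1ℚ * 1ℚ
      ≡⟨ ℚP.*-identityˡ 1ℚ ⟩
    1ℚ ∎
    where open ≡-Reasoning

  F≡inv^-*-colourSum : (G : Multigraph) → ℕ→ℚ (F G q) ≡ inv k ^ n G * colourSum (n G) (edges G)
  F≡inv^-*-colourSum G = begin
    ℕ→ℚ (F G q)                                 ≡⟨ ℚP.*-identityʳ _ ⟨
    ℕ→ℚ (F G q) * 1ℚ                            ≡⟨ cong (ℕ→ℚ (F G q) *_) q^-*-inv^ ⟨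
    ℕ→ℚ (F G q) * (ℕ→ℚ q ^ n G * inv k ^ n G)   ≡⟨ ℚP.*-assoc (ℕ→ℚ (F G q)) _ _ ⟨
    ℕ→ℚ (F G q) * ℕ→ℚ q ^ n G * inv k ^ n G     ≡⟨ cong (_* inv k ^ n G) (F-colourSum G) ⟩
    colourSum (n G) (edges G) * inv k ^ n G     ≡⟨ ℚP.*-comm (colourSum (n G) (edges G)) (inv k ^ n G) ⟩
    inv k ^ n G * colourSum (n G) (edges G)     ∎
    where
    open ≡-Reasoning
    q^-*-inv^ : ℕ→ℚ q ^ n G * inv k ^ n G ≡ 1ℚ
    q^-*-inv^ = trans (ℚP.*-comm (ℕ→ℚ q ^ n G) (inv k ^ n G)) (inv^-*-q^ (n G))

  flowWeight-*-ζ₋₁ : (b : Bool) → flowWeight b * ζ₋₁ k ≡ ind (not b) * ζ₁ k + - 1ℚ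
  flowWeight-*-ζ₋₁ true  = begin
    ℕ→ℚ (suc k) * - recip   ≡⟨ solve 2 (λ K r → K :* (:- r) := :- (r :* K)) refl (ℕ→ℚ (suc k)) recip ⟩
    - (recip * ℕ→ℚ (suc k)) ≡⟨ cong -_ recip-*-q-1 ⟩
    - 1ℚ                    ≡⟨ solve 1 (λ z → :- con 1ℚ := con 0ℚ :* z :+ (:- con 1ℚ)) refl (ζ₁ k) ⟩
    0ℚ * ζ₁ k + - 1ℚ        ∎
    where open ≡-Reasoning
  flowWeight-*-ζ₋₁ false = begin
    - 1ℚ * - recip
      ≡⟨ solve 1 (λ r → (:- con 1ℚ) :* (:- r) := con 1ℚ :* (con 1ℚ :+ r) :+ (:- con 1ℚ)) refl recip ⟩
    1ℚ * (1ℚ + recip) + - 1ℚ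
      ≡⟨ cong (λ z → 1ℚ * z + - 1ℚ) (ζ₁≡1+recip k) ⟨
    1ℚ * ζ₁ k + - 1ℚ ∎
    where open ≡-Reasoning

  ind-not-*-ζ₁ : (b : Bool) → ind (not b) * ζ₁ k ≡ ζ₋₁ k * flowWeight b + 1ℚ
  ind-not-*-ζ₁ true  = begin
    0ℚ * ζ₁ k                           ≡⟨ solve 1 (λ z → con 0ℚ :* z := (:- con 1ℚ) :+ con 1ℚ) refl (ζ₁ k) ⟩
    - 1ℚ + 1ℚ                           ≡⟨ cong (λ x → - x + 1ℚ) recip-*-q-1 ⟨
    - (recip * ℕ→ℚ (suc k)) + 1ℚ
      ≡⟨ solve 2 (λ r K → (:- (r :* K)) :+ con 1ℚ := (:- r) :* K :+ con 1ℚ) refl recip (ℕ→ℚ (suc k)) ⟩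
    - recip * ℕ→ℚ (suc k) + 1ℚ ∎
    where open ≡-Reasoning
  ind-not-*-ζ₁ false = begin
    1ℚ * ζ₁ k               ≡⟨ cong (1ℚ *_) (ζ₁≡1+recip k) ⟩
    1ℚ * (1ℚ + recip)
      ≡⟨ solve 1 (λ r → con 1ℚ :* (con 1ℚ :+ r) := (:- r) :* (:- con 1ℚ) :+ con 1ℚ) refl recip ⟩
    - recip * - 1ℚ + 1ℚ ∎
    where open ≡-Reasoning

  flowWeight-ind : (b : Bool) → flowWeight b ≡ ℕ→ℚ (suc k) * ind b + - 1ℚ * ind (not b)
  flowWeight-ind true  = solve 1 (λ K → K := K :* con 1ℚ :+ (:- con 1ℚ) :* con 0ℚ) refl (ℕ→ℚ (suc k))
  flowWeight-ind false = solve 1 (λ K → :- con 1ℚ := K :* con 0ℚ :+ (:- con 1ℚ) :* con 1ℚ) refl (ℕ→ℚ (suc k))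

  module _ (G : Multigraph) where

    private
      Colourings : List (Vec (Fin q) (n G))
      Colourings = allVec (n G) q

      Marking : Set
      Marking = List (Bool × (Fin (n G) × Fin (n G)))

      signs : (H : Marking) → length H ≡ |E| G →
              (- 1ℚ) ^ (|E| G ∸ |E|of H) ≡ Πℚ H (select (const 1ℚ) (const (- 1ℚ)))
      signs H ∣H∣≡∣E∣ = trans (cong (λ l → (- 1ℚ) ^ (l ∸ |E|of H)) (sym ∣H∣≡∣E∣)) (^-unmarked (- 1ℚ) H)

      P-subgraph : (H : Marking) →
                   ℕ→ℚ (P (subgraph G H) q) ≡ Σℚ Colourings (λ c → Πℚ H (select (bichromatic c) (const 1ℚ)))
      P-subgraph H =
        trans (P-Σ-colourings (subgraph G H)) (Σℚ-cong Colourings (λ c → Πℚ-subgraph G H (bichromatic c)))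

      Σ-flowWeight-* : (z : ℚ) →
        colourSum (n G) (edges G) * Πℚ (edges G) (const z)
          ≡ Σℚ Colourings (λ c → Πℚ (edges G) (λ e → flowWeight (monochromatic c e) * z))
      Σ-flowWeight-* z =
        trans (sym (Σℚ-*ʳ Colourings _ _)) (Σℚ-cong Colourings (λ c → sym (Πℚ-* (edges G) _ _)))

      summand₁ summand₂ summand₃ : Marking → ℚ
      summand₁ H = ((- 1ℚ) ^ (|E| G ∸ |E|of H)) * (ℕ→ℚ (P (subgraph G H) q) * (inv k ^ |V| G)) * (ζ₁ k ^ |E|of H)
      summand₂ H = (ζ₋₁ k ^ |E|of H) * ℕ→ℚ (F (subgraph G H) q)
      summand₃ H = ((- 1ℚ) ^ (|E| G ∸ |E|of H)) * (ℕ→ℚ (suc k) ^ |E|of H) * ℕ→ℚ (P (contract G H) q)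

      a₁ a₂ a₃ b₃ : Vec (Fin q) (n G) → Fin (n G) × Fin (n G) → ℚ
      a₁ c e = bichromatic c e * ζ₁ k
      a₂ c e = ζ₋₁ k * flowWeight (monochromatic c e)
      a₃ c e = ℕ→ℚ (suc k) * ind (monochromatic c e)
      b₃ c e = - 1ℚ * bichromatic c e

      summand₁-expand : (H : Marking) → length H ≡ |E| G →
        summand₁ H ≡ inv k ^ n G * Σℚ Colourings (λ c → Πℚ H (select (a₁ c) (const (- 1ℚ))))
      summand₁-expand H ∣H∣≡∣E∣ = begin
        summand₁ H
          ≡⟨ cong₂ (λ a b → a * b * (ζ₁ k ^ |E|of H))
                   (signs H ∣H∣≡∣E∣) (cong (_* (inv k ^ n G)) (P-subgraph H)) ⟩
        Sg * (Σℚ Colourings Bi * inv k ^ n G) * (ζ₁ k ^ |E|of H)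
          ≡⟨ cong (Sg * (Σℚ Colourings Bi * inv k ^ n G) *_) (^-marked (ζ₁ k) H) ⟩
        Sg * (Σℚ Colourings Bi * inv k ^ n G) * Z
          ≡⟨ solve 4 (λ a s y z → a :* (s :* y) :* z := y :* (a :* s :* z))
                   refl Sg (Σℚ Colourings Bi) (inv k ^ n G) Z ⟩
        inv k ^ n G * (Sg * Σℚ Colourings Bi * Z)
          ≡⟨ cong (inv k ^ n G *_) (Σℚ-sandwich Colourings Sg Z Bi) ⟩
        inv k ^ n G * Σℚ Colourings (λ c → Sg * Bi c * Z)
          ≡⟨ cong (inv k ^ n G *_) (Σℚ-cong Colourings (λ c →
               trans (cong (_* Z) (Πℚ-select-* H {f″ = bichromatic c} {g″ = const (- 1ℚ)}
                                    (λ _ → ℚP.*-identityˡ _) (λ _ → ℚP.*-identityʳ (- 1ℚ))))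
                     (Πℚ-select-* H (λ _ → refl) (λ _ → ℚP.*-identityʳ (- 1ℚ))))) ⟩
        inv k ^ n G * Σℚ Colourings (λ c → Πℚ H (select (a₁ c) (const (- 1ℚ)))) ∎
        where
        open ≡-Reasoning
        Sg Z : ℚ
        Sg = Πℚ H (select (const 1ℚ) (const (- 1ℚ)))
        Z  = Πℚ H (select (const (ζ₁ k)) (const 1ℚ))
        Bi : Vec (Fin q) (n G) → ℚ
        Bi c = Πℚ H (select (bichromatic c) (const 1ℚ))

      summand₂-expand : (H : Marking) →
        summand₂ H ≡ inv k ^ n G * Σℚ Colourings (λ c → Πℚ H (select (a₂ c) (const 1ℚ)))
      summand₂-expand H = begin
        summand₂ H
          ≡⟨ cong₂ _*_ (^-marked (ζ₋₁ k) H) (F≡inv^-*-colourSum (subgraph G H)) ⟩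
        Z * (inv k ^ n G * colourSum (n G) (edges (subgraph G H)))
          ≡⟨ solve 3 (λ z y s → z :* (y :* s) := y :* (z :* s)) refl Z (inv k ^ n G) _ ⟩
        inv k ^ n G * (Z * colourSum (n G) (edges (subgraph G H)))
          ≡⟨ cong (inv k ^ n G *_) (sym (Σℚ-*ˡ Colourings Z _)) ⟩
        inv k ^ n G * Σℚ Colourings (λ c → Z * Πℚ (edges (subgraph G H)) (flowWeight ∘ monochromatic c))
          ≡⟨ cong (inv k ^ n G *_) (Σℚ-cong Colourings (λ c → trans
               (cong (Z *_) (Πℚ-subgraph G H (flowWeight ∘ monochromatic c)))
               (Πℚ-select-* H (λ _ → refl) (λ _ → ℚP.*-identityˡ 1ℚ)))) ⟩
        inv k ^ n G * Σℚ Colourings (λ c → Πℚ H (select (a₂ c) (const 1ℚ))) ∎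
        where
        open ≡-Reasoning
        Z : ℚ
        Z = Πℚ H (select (const (ζ₋₁ k)) (const 1ℚ))

      summand₃-expand : (H : Marking) → length H ≡ |E| G →
                        summand₃ H ≡ 1ℚ * Σℚ Colourings (λ c → Πℚ H (select (a₃ c) (b₃ c)))
      summand₃-expand H ∣H∣≡∣E∣ = begin
        summand₃ H
          ≡⟨ cong₂ _*_ (cong₂ _*_ (signs H ∣H∣≡∣E∣) (^-marked (ℕ→ℚ (suc k)) H)) (P-contract G H) ⟩
        Πℚ H (select (const 1ℚ) (const (- 1ℚ))) * Πℚ H (select (const (ℕ→ℚ (suc k))) (const 1ℚ))
          * Σℚ Colourings (λ c → Πℚ H (contractWeight c))
          ≡⟨ cong (_* Σℚ Colourings (λ c → Πℚ H (contractWeight c)))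
               (Πℚ-select-* H (λ _ → ℚP.*-identityˡ (ℕ→ℚ (suc k))) (λ _ → ℚP.*-identityʳ (- 1ℚ))) ⟩
        W * Σℚ Colourings (λ c → Πℚ H (contractWeight c))
          ≡⟨ Σℚ-*ˡ Colourings W _ ⟨
        Σℚ Colourings (λ c → W * Πℚ H (contractWeight c))
          ≡⟨ Σℚ-cong Colourings (λ c → Πℚ-select-* H (λ _ → refl) (λ _ → refl)) ⟩
        Σℚ Colourings (λ c → Πℚ H (select (a₃ c) (b₃ c)))
          ≡⟨ ℚP.*-identityˡ _ ⟨
        1ℚ * Σℚ Colourings (λ c → Πℚ H (select (a₃ c) (b₃ c))) ∎
        where
        open ≡-Reasoning
        W : ℚ
        W = Πℚ H (select (const (ℕ→ℚ (suc k))) (const (- 1ℚ)))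

    F-as-Σ-P-subgraphs : ℕ→ℚ (F G q) * (ζ₋₁ k ^ |E| G) ≡ Σℚ (Spanning G) summand₁
    F-as-Σ-P-subgraphs = begin
      ℕ→ℚ (F G q) * (ζ₋₁ k ^ |E| G)
        ≡⟨ cong₂ _*_ (F≡inv^-*-colourSum G) (sym (Πℚ-const (edges G) (ζ₋₁ k))) ⟩
      inv k ^ n G * colourSum (n G) (edges G) * Πℚ (edges G) (const (ζ₋₁ k))
        ≡⟨ trans (ℚP.*-assoc (inv k ^ n G) _ _) (cong (inv k ^ n G *_) (Σ-flowWeight-* (ζ₋₁ k))) ⟩
      inv k ^ n G * Σℚ Colourings (λ c → Πℚ (edges G) (λ e → flowWeight (monochromatic c e) * ζ₋₁ k))
        ≡⟨ cong (inv k ^ n G *_) (Σℚ-cong Colourings (λ c →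
             Πℚ-cong (edges G) (flowWeight-*-ζ₋₁ ∘ monochromatic c))) ⟩
      inv k ^ n G * Σℚ Colourings (λ c → Πℚ (edges G) (λ e → a₁ c e + - 1ℚ))
        ≡⟨ Σ-markings-expand (edges G) Colourings (inv k ^ n G) a₁ (λ _ _ → - 1ℚ) summand₁
             (All.map (λ {H} → summand₁-expand H) (markings-length (edges G))) ⟨
      Σℚ (Spanning G) summand₁ ∎
      where open ≡-Reasoning

    P-as-Σ-F-subgraphs : ℕ→ℚ (P G q) * (inv k ^ |V| G) * (ζ₁ k ^ |E| G) ≡ Σℚ (Spanning G) summand₂
    P-as-Σ-F-subgraphs = begin
      ℕ→ℚ (P G q) * (inv k ^ n G) * (ζ₁ k ^ |E| G)
        ≡⟨ cong₂ (λ p z → p * (inv k ^ n G) * z) (P-Σ-colourings G) (sym (Πℚ-const (edges G) (ζ₁ k))) ⟩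
      Σℚ Colourings Bi * (inv k ^ n G) * Πℚ (edges G) (const (ζ₁ k))
        ≡⟨ solve 3 (λ s y z → s :* y :* z := y :* (s :* z)) refl (Σℚ Colourings Bi) (inv k ^ n G) _ ⟩
      inv k ^ n G * (Σℚ Colourings Bi * Πℚ (edges G) (const (ζ₁ k)))
        ≡⟨ cong (inv k ^ n G *_) (trans (sym (Σℚ-*ʳ Colourings _ _)) (Σℚ-cong Colourings (λ c →
             trans (sym (Πℚ-* (edges G) _ _)) (Πℚ-cong (edges G) (ind-not-*-ζ₁ ∘ monochromatic c))))) ⟩
      inv k ^ n G * Σℚ Colourings (λ c → Πℚ (edges G) (λ e → a₂ c e + 1ℚ))
        ≡⟨ Σ-markings-expand (edges G) Colourings (inv k ^ n G) a₂ (λ _ _ → 1ℚ) summand₂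
             (All.universal summand₂-expand (markings (edges G))) ⟨
      Σℚ (Spanning G) summand₂ ∎
      where
      open ≡-Reasoning
      Bi : Vec (Fin q) (n G) → ℚ
      Bi c = Πℚ (edges G) (bichromatic c)

    F-as-Σ-P-contractions : ℕ→ℚ (F G q) * (ℕ→ℚ q ^ |V| G) ≡ Σℚ (Spanning G) summand₃
    F-as-Σ-P-contractions = begin
      ℕ→ℚ (F G q) * (ℕ→ℚ q ^ n G)
        ≡⟨ F-colourSum G ⟩
      colourSum (n G) (edges G)
        ≡⟨ Σℚ-cong Colourings (λ c → Πℚ-cong (edges G) (flowWeight-ind ∘ monochromatic c)) ⟩
      Σℚ Colourings (λ c → Πℚ (edges G) (λ e → a₃ c e + b₃ c e))
        ≡⟨ ℚP.*-identityˡ _ ⟨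
      1ℚ * Σℚ Colourings (λ c → Πℚ (edges G) (λ e → a₃ c e + b₃ c e))
        ≡⟨ Σ-markings-expand (edges G) Colourings 1ℚ a₃ b₃ summand₃
             (All.map (λ {H} → summand₃-expand H) (markings-length (edges G))) ⟨
      Σℚ (Spanning G) summand₃ ∎
      where open ≡-Reasoning

corollary1 : (G : Multigraph) → (k : ℕ) →
    (ℕ→ℚ (F G (suc (suc k))) * (ζ₋₁ k ^ |E| G)
      ≡ Σℚ (Spanning G) (λ H →
          ((- 1ℚ) ^ (|E| G ∸ |E|of H)) * (ℕ→ℚ (P (subgraph G H) (suc (suc k))) * (inv k ^ |V| G))
            * (ζ₁ k ^ |E|of H)))
    × (ℕ→ℚ (P G (suc (suc k))) * (inv k ^ |V| G) * (ζ₁ k ^ |E| G)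
      ≡ Σℚ (Spanning G) (λ H →
          (ζ₋₁ k ^ |E|of H) * ℕ→ℚ (F (subgraph G H) (suc (suc k)))))
    × (ℕ→ℚ (F G (suc (suc k))) * (ℕ→ℚ (suc (suc k)) ^ |V| G)
      ≡ Σℚ (Spanning G) (λ H →
          ((- 1ℚ) ^ (|E| G ∸ |E|of H)) * (ℕ→ℚ (suc k) ^ |E|of H)
            * ℕ→ℚ (P (contract G H) (suc (suc k)))))
corollary1 G k = F-as-Σ-P-subgraphs G , P-as-Σ-F-subgraphs G , F-as-Σ-P-contractions G
  where open Identities k
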